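{- Let $\mathbf{k}$ be a field of characteristic $0$ and let $(A,\zeta)$ be a combinatorial Hopf superalgebra over $\mathbf{k}$, with $A=\bigoplus_{k\ge0}A^k$ and supercharacter $\zeta\colon A\to\mathbf{k}[\varepsilon]$. Then there exists a unique graded even morphism of graded Hopf superalgebras $\Psi\colon A\to\mathrm{sQSym}$ such that $\zeta=\zeta_Q\circ\Psi$. In other words, $(\mathrm{sQSym},\zeta_Q)$ is a terminal object of the category of combinatorial Hopf superalgebras.
   Context: A superspace is a $\mathbb{Z}/2\mathbb{Z}$-graded vector space $V=V_{\bar0}\oplus V_{\bar1}$; $|v|$ denotes the parity of a homogeneous element. The tensor product of superspaces is graded by total parity, and for homogeneous linear maps $(f\otimes g)(v\otimes w)=(-1)^{|g||v|}f(v)\otimes g(w)$; the symmetry is $v\otimes w\mapsto(-1)^{|v||w|}w\otimes v$. A Hopf superalgebra is a Hopf algebra object in this symmetric monoidal category of superspaces: a superspace $H$ with even multiplication, unit, comultiplication $\Delta$, counit and antipode satisfying the Hopf algebra axioms, where $H\otimes H$ carries the product $(a\otimes b)(c\otimes d)=(-1)^{|b||c|}ac\otimes bd$. It is graded if it carries an additional $\mathbb{N}$-grading $H=\bigoplus_{k\ge0}H^k$, $H^k=H^k_{\bar0}\oplus H^k_{\bar1}$, compatible with all structure maps, and connected graded if moreover $H^0=\mathbf{k}$. A graded morphism of Hopf superalgebras is a Hopf superalgebra morphism preserving the $\mathbb{N}$-grading. $\mathbf{k}[\varepsilon]=\mathbf{k}\oplus\mathbf{k}\varepsilon$ is the commutative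 superalgebra generated by one odd element $\varepsilon$ ($\varepsilon^2=0$). A supercharacter of a Hopf superalgebra $H$ is an even superalgebra morphism $\zeta\colon H\to\mathbf{k}[\varepsilon]$. A combinatorial Hopf superalgebra is a pair $(H,\zeta)$ of a connected graded Hopf superalgebra $H$ and a supercharacter $\zeta$; a morphism $(H,\zeta)\to(H',\zeta')$ is a graded even Hopf superalgebra morphism $\psi\colon H\to H'$ with $\zeta=\zeta'\circ\psi$. Quasi-symmetric functions in superspace: let $x_1,x_2,\dots$ be even commuting variables and $\theta_1,\theta_2,\dots$ odd variables ($\theta_i\theta_j=-\theta_j\theta_i$, $\theta_i^2=0$) commuting with the $x$'s, and let $R$ be the ring of formal power series of bounded degree in these. A dotted composition is a finite sequence $\alpha=(\alpha_1,\dots,\alpha_l)$ with entries in $\{1,2,3,\dots\}\cup\{\dot0,\dot1,\dot2,\dots\}$; set $\eta_k=1$ if $\alpha_k$ is dotted and $\eta_k=0$ otherwise. Its total degree is $\sum_k\alpha_k$ (a dotted entry $\dot n$ counts as $n$) and its fermionic degree is the number of dotted entries. Define $M_\alpha=\sum_{i_1<\dots<i_l}\theta_{i_1}^{\eta_1}\cdots\theta_{i_l}^{\eta_l}x_{i_1}^{\alpha_1}\cdots x_{i_l}^{\alpha_l}$ (dotted $\dot n$ used as exponent $n$). $\mathrm{sQSym}\subset R$ is the space of $f\in R$ such that for every dotted composition $\alpha$, all monomials $\theta_{i_1}^{\eta_1}\cdots\theta_{i_l}^{\eta_l}x_{i_1}^{\alpha_1}\cdots x_{i_l}^{\alpha_l}$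 with $i_1<\dots<i_l$ have the same coefficient in $f$; the $M_\alpha$ form a basis. $\mathrm{sQSym}_{n,m}$ is spanned by $M_\alpha$ of total degree $n$ and fermionic degree $m$; the parity is $m\bmod 2$ and the $\mathbb{N}$-grading is $\mathrm{sQSym}^k=\bigoplus_{n+m=k}\mathrm{sQSym}_{n,m}$. The product is multiplication of series, and $\Delta(M_{(\alpha_1,\dots,\alpha_l)})=\sum_{k=0}^{l}M_{(\alpha_1,\dots,\alpha_k)}\otimes M_{(\alpha_{k+1},\dots,\alpha_l)}$; with this (and its unique antipode) $\mathrm{sQSym}$ is a connected graded commutative Hopf superalgebra (Fishel–Lapointe–Pinto). $\zeta_Q\colon\mathrm{sQSym}\to\mathbf{k}[\varepsilon]$ is the specialization $x_1=1$, $\theta_1=\varepsilon$, $x_i=\theta_i=0$ for $i\ge2$; it is a supercharacter. -}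

module Defs where

open import Level using (Level; _⊔_) renaming (suc to lsuc)
open import Algebra.Bundles using (CommutativeRing)
open import Algebra.Module.Bundles using (Module)
open import Data.Nat using (ℕ; zero; suc; _∸_; _≤_; _<_; _≤?_)
import Data.Nat as ℕ
open import Data.Bool using (Bool; true; false; if_then_else_; _xor_)
import Data.Bool.Properties as BoolP
open import Data.List using (List; []; _∷_; _++_; [_]; map; concatMap; foldr; upTo; length; take; drop; filter)
import Data.List.Properties as ListP
open import Data.Vec using (Vec)
import Data.Vec as Vec
open import Data.Product using (Σ; ∃; _×_; _,_; proj₁; proj₂)
import Data.Product.Properties as ProdP
open import Relation.Binary.PropositionalEquality using (_≡_; _≢_)
open import Relation.Nullary using (¬_; Dec; yes; no)
open import Relation.Nullary.Decidable using (⌊_⌋)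

record Field (c ℓ : Level) : Set (lsuc (c ⊔ ℓ)) where
  field
    commutativeRing : CommutativeRing c ℓ
  open CommutativeRing commutativeRing public
  field
    1≉0     : ¬ (1# ≈ 0#)
    inverse : ∀ x → ¬ (x ≈ 0#) → ∃ λ y → (x * y) ≈ 1#

module FieldOps {c ℓ} (K : Field c ℓ) where
  open Field K
  nat : ℕ → Carrier
  nat zero    = 0#
  nat (suc n) = 1# + nat n

  sumK : List Carrier → Carrier
  sumK = foldr _+_ 0#

CharZero : ∀ {c ℓ} → Field c ℓ → Set ℓ
CharZero K = ∀ n → nat n ≈ 0# → n ≡ 0
  where open Field K
        open FieldOps K

data Parity : Set where
  even odd : Parity

_⊕_ : Parity → Parity → Parity
even ⊕ p = p
odd  ⊕ even = odd
odd  ⊕ odd  = even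

-- Monomials in x₁,x₂,… (even) and θ₁,θ₂,… (odd).
-- A monomial is a list whose i-th entry (e , b) (i = 1,2,…) records the
-- exponent e of x_i and whether θ_i occurs (b).  The monomial is written in
-- the normal form θ_{i₁}⋯θ_{i_k} x^e with i₁ < ⋯ < i_k.  Lists differing by
-- trailing (0 , false) entries denote the same monomial; series are required
-- to be invariant under this (see Trailing below).

Monomial : Set
Monomial = List (ℕ × Bool)

degM : Monomial → ℕ
degM = foldr (λ { (e , b) r → e ℕ.+ (if b then 1 else 0) ℕ.+ r }) 0

parM : Monomial → Parity
parM = foldr (λ { (e , b) r → if b then odd ⊕ r else r }) even

_≟P_ : (p q : Parity) → Dec (p ≡ q)
even ≟P even = yes _≡_.refl
even ≟P odd  = no λ ()
odd  ≟P even = no λ ()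
odd  ≟P odd  = yes _≡_.refl

_≟M_ : (m m' : Monomial) → Dec (m ≡ m')
_≟M_ = ListP.≡-dec (ProdP.≡-dec ℕ._≟_ BoolP._≟_)

-- All ways to write a monomial m (up to sign) as a product m₁ · m₂.
-- Entry (m₁ , m₂ , s): θ^{S₁}x^{a}·θ^{S₂}x^{b} = (-1)^s θ^{S}x^{a+b}, where the
-- sign counts the pairs (s₁ ∈ S₁ , s₂ ∈ S₂) with s₁ > s₂.
nθ-odd : Monomial → Bool
nθ-odd m with parM m
... | even = false
... | odd  = true

splits : Monomial → List (Monomial × Monomial × Bool)
splits [] = ([] , [] , false) ∷ []
splits ((e , false) ∷ m) =
  concatMap (λ { (m₁ , m₂ , s) →
    map (λ a → ((a , false) ∷ m₁) , ((e ∸ a , false) ∷ m₂) , s) (upTo (suc e)) })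
    (splits m)
splits ((e , true) ∷ m) =
  concatMap (λ { (m₁ , m₂ , s) →
    map (λ a → ((a , true) ∷ m₁) , ((e ∸ a , false) ∷ m₂) , s) (upTo (suc e))
    ++ map (λ a → ((a , false) ∷ m₁) , ((e ∸ a , true) ∷ m₂) , (s xor nθ-odd m₁))
           (upTo (suc e)) })
    (splits m)

-- Dotted compositions.  'pos k' is the (undotted) positive part k+1,
-- 'dot k' is the dotted part k̇ (k ≥ 0).

data Entry : Set where
  pos : ℕ → Entry
  dot : ℕ → Entry

DComp : Set
DComp = List Entry

entryM : Entry → ℕ × Bool
entryM (pos k) = (suc k , false)
entryM (dot k) = (k , true)

weight : Entry → ℕ
weight (pos k) = suc k
weight (dot k) = suc k

weightC : DComp → ℕ
weightC = foldr (λ e r → weight e ℕ.+ r) 0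

-- the monomial θ_{i₁}^{η₁}⋯θ_{i_l}^{η_l} x_{i₁}^{α₁}⋯x_{i_l}^{α_l}, where the
-- strictly increasing indices are given by gaps: i₁ = g₁ + 1,
-- i_{k+1} = i_k + g_{k+1} + 1.
monoAt : (α : DComp) → Vec ℕ (length α) → Monomial
monoAt []      _              = []
monoAt (e ∷ α) (g Vec.∷ gs) = Data.List.replicate g (0 , false) ++ (entryM e ∷ monoAt α gs)

monoα : DComp → Monomial
monoα α = map entryM α

compress : Monomial → Monomial
compress [] = []
compress ((zero , false) ∷ m) = compress m
compress (p ∷ m) = p ∷ compress m

-- all entries of weight ≤ n, and all dotted compositions of weight ≤ D
-- (each exactly once)
entries≤ : ℕ → List Entry
entries≤ n = concatMap (λ k → pos k ∷ dot k ∷ []) (upTo n)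

comps≤ : ℕ → List DComp
comps≤ zero    = [] ∷ []
comps≤ (suc D) = [] ∷ concatMap (λ e →
    filter (λ α → weightC α ≤? suc D) (map (e ∷_) (comps≤ D)))
  (entries≤ (suc D))

module Super {c ℓ} (K : Field c ℓ) where
  open Field K using (commutativeRing) renaming (Carrier to 𝕜; _≈_ to _≈ₖ_;
    _+_ to _+ₖ_; _*_ to _*ₖ_; -_ to -ₖ_; 0# to 0ₖ; 1# to 1ₖ)
  open FieldOps K

  -- raw vector-space data (only what is needed to form tensor products)

  record RawVS (a ℓa : Level) : Set (lsuc (a ⊔ ℓa) ⊔ c) where
    infix 4 _≈_
    infixl 6 _+_
    field
      Carrier : Set a
      _≈_     : Carrier → Carrier → Set ℓa
      _+_     : Carrier → Carrier → Carrier
      0v      : Carrier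
      -_      : Carrier → Carrier
      _·_     : 𝕜 → Carrier → Carrier

    sumV : List Carrier → Carrier
    sumV = foldr _+_ 0v

  -- tensor product V ⊗ W: finite formal sums of pure tensors (lists of
  -- pairs) modulo the congruence generated by bilinearity.

  module TensorOps {a ℓa b ℓb} (V : RawVS a ℓa) (W : RawVS b ℓb) where
    private
      module V = RawVS V
      module W = RawVS W

    Tens : Set (a ⊔ b)
    Tens = List (V.Carrier × W.Carrier)

    infix 4 _≈⊗_
    data _≈⊗_ : Tens → Tens → Set (c ⊔ a ⊔ b ⊔ ℓa ⊔ ℓb) where
      ≈⊗-refl  : ∀ {t} → t ≈⊗ t
      ≈⊗-sym   : ∀ {t u} → t ≈⊗ u → u ≈⊗ t
      ≈⊗-trans : ∀ {t u w} → t ≈⊗ u → u ≈⊗ w → t ≈⊗ w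
      ++-cong  : ∀ {t t' u u'} → t ≈⊗ t' → u ≈⊗ u' → t ++ u ≈⊗ t' ++ u'
      ++-comm  : ∀ t u → t ++ u ≈⊗ u ++ t
      pair-cong : ∀ {v v' w w'} → v V.≈ v' → w W.≈ w' →
                  [ (v , w) ] ≈⊗ [ (v' , w') ]
      addˡ  : ∀ v v' w → [ (v V.+ v' , w) ] ≈⊗ (v , w) ∷ (v' , w) ∷ []
      addʳ  : ∀ v w w' → [ (v , w W.+ w') ] ≈⊗ (v , w) ∷ (v , w') ∷ []
      scal  : ∀ k v w → [ (k V.· v , w) ] ≈⊗ [ (v , k W.· w) ]
      zeroˡ : ∀ w → [ (V.0v , w) ] ≈⊗ []

    _·⊗_ : 𝕜 → Tens → Tens
    k ·⊗ t = map (λ { (v , w) → (k V.· v , w) }) t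

    tensorVS : RawVS (a ⊔ b) (c ⊔ a ⊔ b ⊔ ℓa ⊔ ℓb)
    tensorVS = record
      { Carrier = Tens ; _≈_ = _≈⊗_ ; _+_ = _++_ ; 0v = []
      ; -_ = map (λ { (v , w) → (V.- v , w) }) ; _·_ = _·⊗_ }

    lift⊗ : ∀ {u ℓu} (U : RawVS u ℓu) → (V.Carrier → W.Carrier → RawVS.Carrier U) →
            Tens → RawVS.Carrier U
    lift⊗ U β t = RawVS.sumV U (map (λ { (v , w) → β v w }) t)

  -- f ⊗ g on pure tensors (for even maps f, g, no Koszul sign arises)
  _⊗ᶠ_ : ∀ {a b a' b'} {X : Set a} {Y : Set b} {X' : Set a'} {Y' : Set b'} →
         (X → X') → (Y → Y') → List (X × Y) → List (X' × Y')
  (f ⊗ᶠ g) t = map (λ { (x , y) → (f x , g y) }) t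

  assoc⊗ : ∀ {a b u} {X : Set a} {Y : Set b} {Z : Set u} →
           List (List (X × Y) × Z) → List (X × List (Y × Z))
  assoc⊗ = concatMap (λ { (t , z) → map (λ { (x , y) → (x , [ (y , z) ]) }) t })

  -- k[ε] = k ⊕ kε, elements (a , b) = a + bε

  𝕜[ε] : Set c
  𝕜[ε] = 𝕜 × 𝕜

  _≈ε_ : 𝕜[ε] → 𝕜[ε] → Set ℓ
  (a , b) ≈ε (a' , b') = (a ≈ₖ a') × (b ≈ₖ b')

  _+ε_ : 𝕜[ε] → 𝕜[ε] → 𝕜[ε]
  (a , b) +ε (a' , b') = (a +ₖ a' , b +ₖ b')

  _·ε_ : 𝕜 → 𝕜[ε] → 𝕜[ε]
  k ·ε (a , b) = (k *ₖ a , k *ₖ b)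

  _*ε_ : 𝕜[ε] → 𝕜[ε] → 𝕜[ε]
  (a , b) *ε (a' , b') = (a *ₖ a' , (a *ₖ b') +ₖ (b *ₖ a'))

  1ε : 𝕜[ε]
  1ε = (1ₖ , 0ₖ)

  record HopfSuperalgebra (a ℓa : Level) : Set (lsuc (c ⊔ ℓ ⊔ a ⊔ ℓa)) where
    infixl 7 _∙_
    field
      vectorSpace : Module commutativeRing a ℓa
    open Module vectorSpace public

    raw : RawVS a ℓa
    raw = record { Carrier = Carrierᴹ ; _≈_ = _≈ᴹ_ ; _+_ = _+ᴹ_ ; 0v = 0ᴹ
                 ; -_ = -ᴹ_ ; _·_ = _*ₗ_ }
    open RawVS raw public using (sumV)
    open TensorOps raw raw public using () renaming
      (Tens to H⊗H; _≈⊗_ to _≈₂_; _·⊗_ to _·₂_; tensorVS to H⊗H-VS)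
    open TensorOps (TensorOps.tensorVS raw raw) raw public using () renaming
      (_≈⊗_ to _≈[₂₁]_ ; Tens to [H⊗H]⊗H)
    open TensorOps raw (TensorOps.tensorVS raw raw) public using () renaming
      (_≈⊗_ to _≈[₁₂]_ ; Tens to H⊗[H⊗H])

    field
      -- Z/2-grading, given by the projections onto H₀̄ and H₁̄
      par : Parity → Carrierᴹ → Carrierᴹ
      _∙_ : Carrierᴹ → Carrierᴹ → Carrierᴹ
      1H  : Carrierᴹ
      Δ   : Carrierᴹ → H⊗H
      ε   : Carrierᴹ → 𝕜
      S   : Carrierᴹ → Carrierᴹ

    -- the product on H ⊗ H: (a ⊗ b)(c ⊗ d) = (-1)^{|b||c|} ac ⊗ bd
    _⋆_ : H⊗H → H⊗H → H⊗H
    t ⋆ u = concatMap (λ { (a' , b') → concatMap (λ { (c' , d') →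
        (a' ∙ par even c' , b' ∙ d')
      ∷ (a' ∙ par odd c' , par even b' ∙ d')
      ∷ (a' ∙ par odd c' , -ᴹ (par odd b' ∙ d')) ∷ [] }) u }) t

    par₂ : Parity → H⊗H → H⊗H
    par₂ r t = (par even ⊗ᶠ par r) t ++ (par odd ⊗ᶠ par (odd ⊕ r)) t

    field
      par-cong  : ∀ p {x y} → x ≈ᴹ y → par p x ≈ᴹ par p y
      par-+     : ∀ p x y → par p (x +ᴹ y) ≈ᴹ par p x +ᴹ par p y
      par-·     : ∀ p k x → par p (k *ₗ x) ≈ᴹ k *ₗ par p x
      par-sum   : ∀ x → x ≈ᴹ par even x +ᴹ par odd x
      par-idem  : ∀ p x → par p (par p x) ≈ᴹ par p x
      par-orth  : ∀ p q x → p ≢ q → par p (par q x) ≈ᴹ 0ᴹ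
      ∙-cong    : ∀ {x x' y y'} → x ≈ᴹ x' → y ≈ᴹ y' → x ∙ y ≈ᴹ x' ∙ y'
      ∙-assoc   : ∀ x y z → (x ∙ y) ∙ z ≈ᴹ x ∙ (y ∙ z)
      ∙-identityˡ : ∀ x → 1H ∙ x ≈ᴹ x
      ∙-identityʳ : ∀ x → x ∙ 1H ≈ᴹ x
      ∙-distribˡ : ∀ x y z → x ∙ (y +ᴹ z) ≈ᴹ x ∙ y +ᴹ x ∙ z
      ∙-distribʳ : ∀ x y z → (y +ᴹ z) ∙ x ≈ᴹ y ∙ x +ᴹ z ∙ x
      ∙-·ˡ      : ∀ k x y → (k *ₗ x) ∙ y ≈ᴹ k *ₗ (x ∙ y)
      ∙-·ʳ      : ∀ k x y → x ∙ (k *ₗ y) ≈ᴹ k *ₗ (x ∙ y)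
      ∙-even    : ∀ r x y → par r (x ∙ y) ≈ᴹ
                    par even x ∙ par r y +ᴹ par odd x ∙ par (odd ⊕ r) y
      1-even    : par even 1H ≈ᴹ 1H
      Δ-cong    : ∀ {x y} → x ≈ᴹ y → Δ x ≈₂ Δ y
      Δ-+       : ∀ x y → Δ (x +ᴹ y) ≈₂ Δ x ++ Δ y
      Δ-·       : ∀ k x → Δ (k *ₗ x) ≈₂ k ·₂ Δ x
      Δ-even    : ∀ r x → Δ (par r x) ≈₂ par₂ r (Δ x)
      Δ-coassoc : ∀ x → assoc⊗ ((Δ ⊗ᶠ (λ z → z)) (Δ x)) ≈[₁₂] ((λ z → z) ⊗ᶠ Δ) (Δ x)
      ε-cong    : ∀ {x y} → x ≈ᴹ y → ε x ≈ₖ ε y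
      ε-+       : ∀ x y → ε (x +ᴹ y) ≈ₖ ε x +ₖ ε y
      ε-·       : ∀ k x → ε (k *ₗ x) ≈ₖ k *ₖ ε x
      ε-even    : ∀ x → ε (par odd x) ≈ₖ 0ₖ
      counitˡ   : ∀ x → TensorOps.lift⊗ raw raw raw (λ e y → ε e *ₗ y) (Δ x) ≈ᴹ x
      counitʳ   : ∀ x → TensorOps.lift⊗ raw raw raw (λ y e → ε e *ₗ y) (Δ x) ≈ᴹ x
      Δ-∙       : ∀ x y → Δ (x ∙ y) ≈₂ Δ x ⋆ Δ y
      Δ-1       : Δ 1H ≈₂ [ (1H , 1H) ]
      ε-∙       : ∀ x y → ε (x ∙ y) ≈ₖ ε x *ₖ ε y
      ε-1       : ε 1H ≈ₖ 1ₖ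
      S-cong    : ∀ {x y} → x ≈ᴹ y → S x ≈ᴹ S y
      S-+       : ∀ x y → S (x +ᴹ y) ≈ᴹ S x +ᴹ S y
      S-·       : ∀ k x → S (k *ₗ x) ≈ᴹ k *ₗ S x
      S-even    : ∀ p x → S (par p x) ≈ᴹ par p (S x)
      antipodeˡ : ∀ x → TensorOps.lift⊗ raw raw raw (λ y z → S y ∙ z) (Δ x) ≈ᴹ ε x *ₗ 1H
      antipodeʳ : ∀ x → TensorOps.lift⊗ raw raw raw (λ y z → y ∙ S z) (Δ x) ≈ᴹ ε x *ₗ 1H

  -- connected graded Hopf superalgebras: H = ⊕_{k ≥ 0} H^k, given by the
  -- projections deg k : H → H^k.

  record ConnectedGradedHopfSuperalgebra (a ℓa : Level) : Set (lsuc (c ⊔ ℓ ⊔ a ⊔ ℓa)) where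
    field
      hopf : HopfSuperalgebra a ℓa
    open HopfSuperalgebra hopf public
    field
      deg : ℕ → Carrierᴹ → Carrierᴹ
      deg-cong : ∀ n {x y} → x ≈ᴹ y → deg n x ≈ᴹ deg n y
      deg-+    : ∀ n x y → deg n (x +ᴹ y) ≈ᴹ deg n x +ᴹ deg n y
      deg-·    : ∀ n k x → deg n (k *ₗ x) ≈ᴹ k *ₗ deg n x
      deg-idem : ∀ n x → deg n (deg n x) ≈ᴹ deg n x
      deg-orth : ∀ m n x → m ≢ n → deg m (deg n x) ≈ᴹ 0ᴹ
      deg-fin  : ∀ x → ∃ λ N → (∀ n → N ≤ n → deg n x ≈ᴹ 0ᴹ)
                              × (x ≈ᴹ sumV (map (λ n → deg n x) (upTo N)))
      deg-par  : ∀ n p x → par p (deg n x) ≈ᴹ deg n (par p x)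
      deg-∙    : ∀ n x y → deg n (x ∙ y) ≈ᴹ
                   sumV (map (λ i → deg i x ∙ deg (n ∸ i) y) (upTo (suc n)))
      deg-1    : deg 0 1H ≈ᴹ 1H
      deg-Δ    : ∀ n x → Δ (deg n x) ≈₂
                   concatMap (λ i → (deg i ⊗ᶠ deg (n ∸ i)) (Δ x)) (upTo (suc n))
      deg-ε    : ∀ n x → ε (deg (suc n) x) ≈ₖ 0ₖ
      deg-S    : ∀ n x → S (deg n x) ≈ᴹ deg n (S x)
      connected : ∀ x → ∃ λ k → deg 0 x ≈ᴹ k *ₗ 1H

  record CombinatorialHopfSuperalgebra (a ℓa : Level) : Set (lsuc (c ⊔ ℓ ⊔ a ⊔ ℓa)) where
    field
      cgHopf : ConnectedGradedHopfSuperalgebra a ℓa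
    open ConnectedGradedHopfSuperalgebra cgHopf public
    field
      ζ       : Carrierᴹ → 𝕜[ε]
      ζ-cong  : ∀ {x y} → x ≈ᴹ y → ζ x ≈ε ζ y
      ζ-+     : ∀ x y → ζ (x +ᴹ y) ≈ε (ζ x +ε ζ y)
      ζ-·     : ∀ k x → ζ (k *ₗ x) ≈ε (k ·ε ζ x)
      ζ-∙     : ∀ x y → ζ (x ∙ y) ≈ε (ζ x *ε ζ y)
      ζ-1     : ζ 1H ≈ε 1ε
      ζ-even₀ : ∀ x → proj₂ (ζ (par even x)) ≈ₖ 0ₖ
      ζ-even₁ : ∀ x → proj₁ (ζ (par odd x)) ≈ₖ 0ₖ

  -- The ring R of series in x₁,x₂,… , θ₁,θ₂,… (coefficient functions).

  Series : Set c
  Series = Monomial → 𝕜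

  infix 4 _≈S_
  _≈S_ : Series → Series → Set ℓ
  f ≈S g = ∀ m → f m ≈ₖ g m

  _+S_ : Series → Series → Series
  (f +S g) m = f m +ₖ g m

  _·S_ : 𝕜 → Series → Series
  (k ·S f) m = k *ₖ f m

  0S : Series
  0S _ = 0ₖ

  -S_ : Series → Series
  (-S f) m = -ₖ f m

  _*S_ : Series → Series → Series
  (f *S g) m = sumK (map (λ { (m₁ , m₂ , s) →
      (if s then -ₖ 1ₖ else 1ₖ) *ₖ (f m₁ *ₖ g m₂) }) (splits m))

  seriesVS : RawVS c ℓ
  seriesVS = record { Carrier = Series ; _≈_ = _≈S_ ; _+_ = _+S_ ; 0v = 0S
                    ; -_ = -S_ ; _·_ = _·S_ }

  open TensorOps seriesVS seriesVS public using () renaming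
    (Tens to S⊗S; _≈⊗_ to _≈SS_)

  Trailing : Series → Set ℓ
  Trailing f = ∀ m → f (m ++ [ (0 , false) ]) ≈ₖ f m

  BoundedBy : ℕ → Series → Set ℓ
  BoundedBy D f = ∀ m → D < degM m → f m ≈ₖ 0ₖ

  InR : Series → Set ℓ
  InR f = Trailing f × ∃ λ D → BoundedBy D f

  QSym : Series → Set ℓ
  QSym f = ∀ (α : DComp) (is js : Vec ℕ (length α)) →
           f (monoAt α is) ≈ₖ f (monoAt α js)

  InSQSym : Series → Set ℓ
  InSQSym f = InR f × QSym f

  M : DComp → Series
  M α m with compress m ≟M monoα α
  ... | yes _ = 1ₖ
  ... | no  _ = 0ₖ

  1S : Series
  1S = M []

  -- coefficient of M_α in f ∈ sQSym
  coeffM : DComp → Series → 𝕜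
  coeffM α f = f (monoα α)

  -- Δ(M_(α₁…α_l)) = Σ_k M_(α₁…α_k) ⊗ M_(α_{k+1}…α_l), extended linearly;
  -- D is a degree bound for f
  ΔQ : ℕ → Series → S⊗S
  ΔQ D f = concatMap (λ α →
      map (λ k → (coeffM α f ·S M (take k α) , M (drop k α))) (upTo (suc (length α))))
    (comps≤ D)

  εQ : Series → 𝕜
  εQ f = f []

  parS : Parity → Series → Series
  parS p f m with parM m ≟P p
  ... | yes _ = f m
  ... | no  _ = 0ₖ

  degS : ℕ → Series → Series
  degS n f m with degM m ℕ.≟ n
  ... | yes _ = f m
  ... | no  _ = 0ₖ

  -- ζ_Q : x₁ ↦ 1, θ₁ ↦ ε, other variables ↦ 0 (D a degree bound for f)
  ζQ : ℕ → Series → 𝕜[ε]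
  ζQ D f = ( sumK (map (λ n → f [ (n , false) ]) (upTo (suc D)))
           , sumK (map (λ n → f [ (n , true)  ]) (upTo (suc D))) )

  IsAntipodeQ : (Series → Series) → Set (c ⊔ ℓ)
  IsAntipodeQ S' =
      (∀ f → InSQSym f → InSQSym (S' f))
    × (∀ f g → InSQSym f → InSQSym g → f ≈S g → S' f ≈S S' g)
    × (∀ f g → InSQSym f → InSQSym g → S' (f +S g) ≈S S' f +S S' g)
    × (∀ k f → InSQSym f → S' (k ·S f) ≈S k ·S S' f)
    × (∀ f D → InSQSym f → BoundedBy D f →
         TensorOps.lift⊗ seriesVS seriesVS seriesVS (λ g h → S' g *S h) (ΔQ D f)
           ≈S εQ f ·S 1S)
    × (∀ f D → InSQSym f → BoundedBy D f →
         TensorOps.lift⊗ seriesVS seriesVS seriesVS (λ g h → g *S S' h) (ΔQ D f)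
           ≈S εQ f ·S 1S)

  module _ {a ℓa} (A : CombinatorialHopfSuperalgebra a ℓa) where
    open CombinatorialHopfSuperalgebra A

    IsCombMorphism : (Carrierᴹ → Series) → Set (c ⊔ ℓ ⊔ a ⊔ ℓa)
    IsCombMorphism Ψ =
        (∀ x → InSQSym (Ψ x))
      × (∀ {x y} → x ≈ᴹ y → Ψ x ≈S Ψ y)
      × (∀ x y → Ψ (x +ᴹ y) ≈S Ψ x +S Ψ y)
      × (∀ k x → Ψ (k *ₗ x) ≈S k ·S Ψ x)
      × (∀ p x → Ψ (par p x) ≈S parS p (Ψ x))
      × (∀ n x → Ψ (deg n x) ≈S degS n (Ψ x))
      × (∀ x y → Ψ (x ∙ y) ≈S Ψ x *S Ψ y)
      × (Ψ 1H ≈S 1S)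
      × (∀ x D → BoundedBy D (Ψ x) → ΔQ D (Ψ x) ≈SS (Ψ ⊗ᶠ Ψ) (Δ x))
      × (∀ x → εQ (Ψ x) ≈ₖ ε x)
      × (∀ S' → IsAntipodeQ S' → ∀ x → Ψ (S x) ≈S S' (Ψ x))
      × (∀ x D → BoundedBy D (Ψ x) → ζ x ≈ε ζQ D (Ψ x))

{-# OPTIONS --safe #-}
-- As for Aguiar–Bergeron–Sottile's theorem: if x₁ … x_k are the variables of a monomial θ^η x^α,
-- its coefficient in Ψ x must be (ζ_{α₁} ⊛ ⋯ ⊛ ζ_{α_k} ⊛ ε) x, where ζ_n is the constant part of ζ
-- on degree n and ζ_{ṅ} the ε-coefficient of ζ on degree n + 1. For a single variable this is forced by
-- ζ = ζ_Q ∘ Ψ, and compatibility with Δ splits off the first variable; as an element of sQSym is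
-- determined by these coefficients, Ψ is unique.
-- Conversely, define Ψ by this formula. Connectedness makes the coefficients insensitive to absent
-- variables, which is quasi-symmetry; coassociativity gives compatibility with Δ; the super
-- bialgebra axiom gives multiplicativity, its Koszul sign being the sign in the product of sQSym;
-- and Ψ ∘ S and S′ ∘ Ψ, for any antipode S′ of sQSym, are both left convolution inverses of Ψ,
-- which on a connected graded coalgebra are determined degree by degree.
-- Characteristic 0 is never used.

module Submission where

open import Defs
open import Level using (Level; _⊔_; 0ℓ) renaming (suc to lsuc)
open import Algebra.Bundles using (CommutativeRing)
open import Data.Bool using (Bool; true; false; if_then_else_; _xor_)
open import Data.Empty using (⊥-elim)
open import Data.List using (List; []; _∷_; _++_; [_]; map; concatMap; foldr; upTo; applyUpTo; filter; replicate; length; take; drop)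
import Data.List.Properties as List
open import Data.Nat using (ℕ; zero; suc; _∸_; _<_; _≤_; _≤?_; _<?_; z≤n; s≤s)
import Data.Nat as ℕ
import Data.Nat.Properties as ℕ
open import Data.Product using (Σ; ∃; _×_; _,_; proj₁; proj₂)
open import Data.Sum using (inj₁; inj₂)
open import Function using (_∘_)
open import Relation.Binary.PropositionalEquality as ≡ using (_≡_; _≢_)
open import Relation.Nullary using (¬_; Dec; yes; no; does)

module Sums {c ℓ} (R : CommutativeRing c ℓ) where
  open CommutativeRing R
  open import Relation.Binary.Reasoning.Setoid setoid
  open import Algebra.Properties.CommutativeSemigroup +-commutativeSemigroup
    using () renaming (interchange to +-interchange)
  open import Algebra.Properties.Ring ring using (-‿+-comm; -0#≈0#)

  ∑ : ∀ {x} {X : Set x} → List X → (X → Carrier) → Carrier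
  ∑ xs f = foldr _+_ 0# (map f xs)

  module _ {x} {X : Set x} where

    ∑-cong : ∀ (xs : List X) {f g} → (∀ x → f x ≈ g x) → ∑ xs f ≈ ∑ xs g
    ∑-cong []       f≈g = refl
    ∑-cong (x ∷ xs) f≈g = +-cong (f≈g x) (∑-cong xs f≈g)

    ∑-zero : ∀ (xs : List X) {f} → (∀ x → f x ≈ 0#) → ∑ xs f ≈ 0#
    ∑-zero []       f≈0 = refl
    ∑-zero (x ∷ xs) f≈0 = trans (+-cong (f≈0 x) (∑-zero xs f≈0)) (+-identityˡ 0#)

    ∑-++ : ∀ (xs ys : List X) f → ∑ (xs ++ ys) f ≈ ∑ xs f + ∑ ys f
    ∑-++ []       ys f = sym (+-identityˡ _)
    ∑-++ (x ∷ xs) ys f = trans (+-congˡ (∑-++ xs ys f)) (sym (+-assoc _ _ _))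

    ∑-distrib-+ : ∀ (xs : List X) f g → ∑ xs (λ x → f x + g x) ≈ ∑ xs f + ∑ xs g
    ∑-distrib-+ []       f g = sym (+-identityˡ 0#)
    ∑-distrib-+ (x ∷ xs) f g = trans (+-congˡ (∑-distrib-+ xs f g)) (+-interchange _ _ _ _)

    *-distribˡ-∑ : ∀ k (xs : List X) f → k * ∑ xs f ≈ ∑ xs (λ x → k * f x)
    *-distribˡ-∑ k []       f = zeroʳ k
    *-distribˡ-∑ k (x ∷ xs) f = trans (distribˡ _ _ _) (+-congˡ (*-distribˡ-∑ k xs f))

    *-distribʳ-∑ : ∀ k (xs : List X) f → ∑ xs f * k ≈ ∑ xs (λ x → f x * k)
    *-distribʳ-∑ k []       f = zeroˡ k
    *-distribʳ-∑ k (x ∷ xs) f = trans (distribʳ _ _ _) (+-congˡ (*-distribʳ-∑ k xs f))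

    -‿distrib-∑ : ∀ (xs : List X) f → - ∑ xs f ≈ ∑ xs (λ x → - f x)
    -‿distrib-∑ []       f = -0#≈0#
    -‿distrib-∑ (x ∷ xs) f = trans (sym (-‿+-comm _ _)) (+-congˡ (-‿distrib-∑ xs f))

  module _ {x y} {X : Set x} {Y : Set y} where

    ∑-map : ∀ (h : X → Y) (xs : List X) f → ∑ (map h xs) f ≈ ∑ xs (f ∘ h)
    ∑-map h []       f = refl
    ∑-map h (x ∷ xs) f = +-congˡ (∑-map h xs f)

    ∑-concatMap : ∀ (g : X → List Y) (xs : List X) f →
                  ∑ (concatMap g xs) f ≈ ∑ xs (λ x → ∑ (g x) f)
    ∑-concatMap g []       f = refl
    ∑-concatMap g (x ∷ xs) f = trans (∑-++ (g x) (concatMap g xs) f) (+-congˡ (∑-concatMap g xs f))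

    ∑-comm : ∀ (xs : List X) (ys : List Y) (f : X → Y → Carrier) →
             ∑ xs (λ x → ∑ ys (f x)) ≈ ∑ ys (λ y → ∑ xs (λ x → f x y))
    ∑-comm []       ys f = sym (∑-zero ys (λ _ → refl))
    ∑-comm (x ∷ xs) ys f =
      trans (+-congˡ (∑-comm xs ys f)) (sym (∑-distrib-+ ys (f x) (λ y → ∑ xs (λ x → f x y))))

    ∑-*-∑ : ∀ (xs : List X) (ys : List Y) f g →
            ∑ xs f * ∑ ys g ≈ ∑ xs (λ x → ∑ ys (λ y → f x * g y))
    ∑-*-∑ xs ys f g = trans (*-distribʳ-∑ _ xs f) (∑-cong xs (λ x → *-distribˡ-∑ (f x) ys g))

  ∑⊗ : ∀ {x y} {X : Set x} {Y : Set y} → List (X × Y) → (X → Y → Carrier) → Carrier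
  ∑⊗ t φ = ∑ t (λ p → φ (proj₁ p) (proj₂ p))

  when : ∀ {p} {P : Set p} → Dec P → Carrier → Carrier
  when d v = if does d then v else 0#

  module _ {p} {P : Set p} where

    when-cong : ∀ (d : Dec P) {u v} → u ≈ v → when d u ≈ when d v
    when-cong (yes _) u≈v = u≈v
    when-cong (no _)  u≈v = refl

    when-yes : ∀ (d : Dec P) v → P → when d v ≈ v
    when-yes (yes _) v _ = refl
    when-yes (no ¬p) v p = ⊥-elim (¬p p)

    when-no : ∀ (d : Dec P) v → ¬ P → when d v ≈ 0#
    when-no (yes p) v ¬p = ⊥-elim (¬p p)
    when-no (no _)  v _  = refl

    when-zero : ∀ (d : Dec P) → when d 0# ≈ 0#
    when-zero (yes _) = refl
    when-zero (no _)  = refl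

    ∑-when : ∀ {x} {X : Set x} (d : Dec P) (xs : List X) f → ∑ xs (λ x → when d (f x)) ≈ when d (∑ xs f)
    ∑-when (yes _) xs f = refl
    ∑-when (no _)  xs f = ∑-zero xs (λ _ → refl)

    when-⇔ : ∀ {q} {Q : Set q} (d : Dec P) (d′ : Dec Q) v → (P → Q) → (Q → P) → when d v ≈ when d′ v
    when-⇔ d d′ v p⇒q q⇒p with d′
    ... | yes q = when-yes d v (q⇒p q)
    ... | no ¬q = when-no d v (¬q ∘ p⇒q)

    when-* : ∀ {q} {Q : Set q} (d : Dec P) (d′ : Dec Q) u v → when d u * when d′ v ≈ when d (when d′ (u * v))
    when-* (yes _) (yes _) u v = refl
    when-* (yes _) (no _)  u v = zeroʳ _
    when-* (no _)  d′      u v = zeroˡ _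

  when-when : ∀ {p q r} {P : Set p} {Q : Set q} {R : Set r} (d₁ : Dec P) (d₂ : Dec Q) (d₃ : Dec R) v →
              (P → Q → R) → (R → P) → (R → Q) → when d₁ (when d₂ v) ≈ when d₃ v
  when-when (yes p) (yes q) d₃ v p⇒q⇒r r⇒p r⇒q = sym (when-yes d₃ v (p⇒q⇒r p q))
  when-when (yes p) (no ¬q) d₃ v p⇒q⇒r r⇒p r⇒q = sym (when-no d₃ v (¬q ∘ r⇒q))
  when-when (no ¬p) d₂      d₃ v p⇒q⇒r r⇒p r⇒q = sym (when-no d₃ v (¬p ∘ r⇒p))

  ∑-filter : ∀ {x p} {X : Set x} {P : X → Set p} (P? : ∀ x → Dec (P x)) (xs : List X) f →
             ∑ (filter P? xs) f ≈ ∑ xs (λ x → when (P? x) (f x))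
  ∑-filter P? []       f = refl
  ∑-filter P? (x ∷ xs) f with does (P? x)
  ... | true  = +-congˡ (∑-filter P? xs f)
  ... | false = trans (∑-filter P? xs f) (sym (+-identityˡ _))

  ∑< : ℕ → (ℕ → Carrier) → Carrier
  ∑< zero    g = 0#
  ∑< (suc n) g = g 0 + ∑< n (g ∘ suc)

  ∑-applyUpTo : ∀ {x} {X : Set x} (h : ℕ → X) n f → ∑ (applyUpTo h n) f ≈ ∑< n (f ∘ h)
  ∑-applyUpTo h zero    f = refl
  ∑-applyUpTo h (suc n) f = +-congˡ (∑-applyUpTo (h ∘ suc) n f)

  ∑-upTo : ∀ n f → ∑ (upTo n) f ≈ ∑< n f
  ∑-upTo = ∑-applyUpTo (λ i → i)

  ∑<-cong : ∀ n {g h} → (∀ i → i < n → g i ≈ h i) → ∑< n g ≈ ∑< n h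
  ∑<-cong zero    g≈h = refl
  ∑<-cong (suc n) g≈h = +-cong (g≈h 0 (s≤s z≤n)) (∑<-cong n (λ i i<n → g≈h (suc i) (s≤s i<n)))

  ∑<-zero : ∀ n {g} → (∀ i → i < n → g i ≈ 0#) → ∑< n g ≈ 0#
  ∑<-zero zero    g≈0 = refl
  ∑<-zero (suc n) g≈0 =
    trans (+-cong (g≈0 0 (s≤s z≤n)) (∑<-zero n (λ i i<n → g≈0 (suc i) (s≤s i<n)))) (+-identityˡ 0#)

  ∑<-snoc : ∀ n g → ∑< (suc n) g ≈ ∑< n g + g n
  ∑<-snoc zero    g = trans (+-identityʳ _) (sym (+-identityˡ _))
  ∑<-snoc (suc n) g = trans (+-congˡ (∑<-snoc n (g ∘ suc))) (sym (+-assoc _ _ _))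

  ∑<-distrib-+ : ∀ n g h → ∑< n (λ i → g i + h i) ≈ ∑< n g + ∑< n h
  ∑<-distrib-+ zero    g h = sym (+-identityˡ 0#)
  ∑<-distrib-+ (suc n) g h = trans (+-congˡ (∑<-distrib-+ n _ _)) (+-interchange _ _ _ _)

  ∑<-delta : ∀ n g i₀ → (∀ i → i < n → i ≢ i₀ → g i ≈ 0#) → ∑< n g ≈ when (i₀ <? n) (g i₀)
  ∑<-delta zero    g i₀       g≈0 = refl
  ∑<-delta (suc n) g zero     g≈0 =
    trans (+-congˡ (∑<-zero n (λ i i<n → g≈0 (suc i) (s≤s i<n) (λ ())))) (+-identityʳ _)
  ∑<-delta (suc n) g (suc i₀) g≈0 = begin
    g 0 + ∑< n (g ∘ suc)                  ≈⟨ +-cong (g≈0 0 (s≤s z≤n) (λ ())) (∑<-delta n (g ∘ suc) i₀ g∘suc≈0) ⟩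
    0# + when (i₀ <? n) (g (suc i₀))      ≈⟨ +-identityˡ _ ⟩
    when (i₀ <? n) (g (suc i₀))           ≈⟨ when-⇔ (i₀ <? n) (suc i₀ <? suc n) _ s≤s ℕ.≤-pred ⟩
    when (suc i₀ <? suc n) (g (suc i₀))   ∎
    where g∘suc≈0 = λ i i<n i≢i₀ → g≈0 (suc i) (s≤s i<n) (i≢i₀ ∘ ℕ.suc-injective)

  ∑<-extend : ∀ {m n g} → m ≤ n → (∀ i → m ≤ i → g i ≈ 0#) → ∑< n g ≈ ∑< m g
  ∑<-extend {zero}  {n}     _         g≈0 = ∑<-zero n (λ i _ → g≈0 i z≤n)
  ∑<-extend {suc m} {suc n} (s≤s m≤n) g≈0 = +-congˡ (∑<-extend m≤n (λ i → g≈0 (suc i) ∘ s≤s))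

  ∑<-support : ∀ m n g → (∀ i → m ≤ i → g i ≈ 0#) → (∀ i → n ≤ i → g i ≈ 0#) → ∑< m g ≈ ∑< n g
  ∑<-support m n g g≈0 g≈0′ with ℕ.≤-total m n
  ... | inj₁ m≤n = sym (∑<-extend m≤n g≈0)
  ... | inj₂ n≤m = ∑<-extend n≤m g≈0′

module Compositions where
  open import Data.Vec using (Vec) renaming ([] to []ᵛ; _∷_ to _∷ᵛ_)
  import Data.Vec as Vec
  open import Data.List.Relation.Unary.All using (All; []; _∷_)
  import Data.List.Relation.Unary.All as All
  import Data.List.Relation.Unary.All.Properties as All

  absent : ℕ × Bool
  absent = (0 , false)

  compositionOf : Monomial → DComp
  compositionOf []                    = []
  compositionOf ((k , true) ∷ m)      = dot k ∷ compositionOf m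
  compositionOf ((zero , false) ∷ m)  = compositionOf m
  compositionOf ((suc k , false) ∷ m) = pos k ∷ compositionOf m

  compress≡monoα-compositionOf : ∀ m → compress m ≡ monoα (compositionOf m)
  compress≡monoα-compositionOf []                    = ≡.refl
  compress≡monoα-compositionOf ((zero , false) ∷ m)  = compress≡monoα-compositionOf m
  compress≡monoα-compositionOf ((suc k , false) ∷ m) = ≡.cong (_ ∷_) (compress≡monoα-compositionOf m)
  compress≡monoα-compositionOf ((zero , true) ∷ m)   = ≡.cong (_ ∷_) (compress≡monoα-compositionOf m)
  compress≡monoα-compositionOf ((suc k , true) ∷ m)  = ≡.cong (_ ∷_) (compress≡monoα-compositionOf m)

  compositionOf-monoα : ∀ α → compositionOf (monoα α) ≡ α
  compositionOf-monoα []                = ≡.refl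
  compositionOf-monoα (pos k ∷ α)       = ≡.cong (_ ∷_) (compositionOf-monoα α)
  compositionOf-monoα (dot zero ∷ α)    = ≡.cong (_ ∷_) (compositionOf-monoα α)
  compositionOf-monoα (dot (suc k) ∷ α) = ≡.cong (_ ∷_) (compositionOf-monoα α)

  monoα-injective : ∀ {α β} → monoα α ≡ monoα β → α ≡ β
  monoα-injective {α} {β} eq = ≡.trans (≡.sym (compositionOf-monoα α))
    (≡.trans (≡.cong compositionOf eq) (compositionOf-monoα β))

  degM-monoα : ∀ α → degM (monoα α) ≡ weightC α
  degM-monoα []          = ≡.refl
  degM-monoα (pos k ∷ α) = ≡.cong₂ ℕ._+_ (ℕ.+-identityʳ (suc k)) (degM-monoα α)
  degM-monoα (dot k ∷ α) = ≡.cong₂ ℕ._+_ (ℕ.+-comm k 1) (degM-monoα α)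

  degM-compress : ∀ m → degM (compress m) ≡ degM m
  degM-compress []                    = ≡.refl
  degM-compress ((zero , false) ∷ m)  = degM-compress m
  degM-compress ((suc k , false) ∷ m) = ≡.cong (suc k ℕ.+ 0 ℕ.+_) (degM-compress m)
  degM-compress ((zero , true) ∷ m)   = ≡.cong (1 ℕ.+_) (degM-compress m)
  degM-compress ((suc k , true) ∷ m)  = ≡.cong (suc k ℕ.+ 1 ℕ.+_) (degM-compress m)

  degM≡weightC-compositionOf : ∀ m → degM m ≡ weightC (compositionOf m)
  degM≡weightC-compositionOf m = ≡.trans (≡.sym (degM-compress m))
    (≡.trans (≡.cong degM (compress≡monoα-compositionOf m)) (degM-monoα (compositionOf m)))

  compress-++-absent : ∀ m → compress (m ++ [ absent ]) ≡ compress m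
  compress-++-absent []                    = ≡.refl
  compress-++-absent ((zero , false) ∷ m)  = compress-++-absent m
  compress-++-absent ((suc k , false) ∷ m) = ≡.cong (_ ∷_) (compress-++-absent m)
  compress-++-absent ((zero , true) ∷ m)   = ≡.cong (_ ∷_) (compress-++-absent m)
  compress-++-absent ((suc k , true) ∷ m)  = ≡.cong (_ ∷_) (compress-++-absent m)

  compress-monoAt : ∀ α (gs : Vec ℕ (length α)) → compress (monoAt α gs) ≡ monoα α
  compress-monoAt []      []ᵛ        = ≡.refl
  compress-monoAt (e ∷ α) (g ∷ᵛ gs) =
    ≡.trans (skip g) (≡.trans (keep e) (≡.cong (_ ∷_) (compress-monoAt α gs)))
    where
      skip : ∀ g {r} → compress (replicate g absent ++ r) ≡ compress r
      skip zero    = ≡.refl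
      skip (suc g) = skip g
      keep : ∀ e {r} → compress (entryM e ∷ r) ≡ entryM e ∷ compress r
      keep (pos k)       = ≡.refl
      keep (dot zero)    = ≡.refl
      keep (dot (suc k)) = ≡.refl

  monoAt-adjacent : ∀ α → monoAt α (Vec.replicate (length α) 0) ≡ monoα α
  monoAt-adjacent []      = ≡.refl
  monoAt-adjacent (e ∷ α) = ≡.cong (_ ∷_) (monoAt-adjacent α)

  gap-decomposition : ∀ m → ∃ λ (gs : Vec ℕ (length (compositionOf m))) →
                      ∃ λ t → m ≡ monoAt (compositionOf m) gs ++ replicate t absent
  gap-decomposition [] = []ᵛ , 0 , ≡.refl
  gap-decomposition ((zero , false) ∷ m) with gap-decomposition m
  ... | gs , t , eq = shift (compositionOf m) gs t eq
    where
      shift : ∀ α gs t → m ≡ monoAt α gs ++ replicate t absent →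
              ∃ λ gs′ → ∃ λ t′ → absent ∷ m ≡ monoAt α gs′ ++ replicate t′ absent
      shift []      []ᵛ        t eq = []ᵛ , suc t , ≡.cong (absent ∷_) eq
      shift (e ∷ α) (g ∷ᵛ gs) t eq = suc g ∷ᵛ gs , t , ≡.cong (absent ∷_) eq
  gap-decomposition ((suc k , false) ∷ m) with gap-decomposition m
  ... | gs , t , eq = 0 ∷ᵛ gs , t , ≡.cong (_ ∷_) eq
  gap-decomposition ((k , true) ∷ m) with gap-decomposition m
  ... | gs , t , eq = 0 ∷ᵛ gs , t , ≡.cong (_ ∷_) eq

  infix 4 _≟E_ _≟C_

  _≟E_ : (e e′ : Entry) → Dec (e ≡ e′)
  pos k ≟E pos k′ with k ℕ.≟ k′
  ... | yes ≡.refl = yes ≡.refl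
  ... | no k≢k′    = no (λ { ≡.refl → k≢k′ ≡.refl })
  pos k ≟E dot k′ = no (λ ())
  dot k ≟E pos k′ = no (λ ())
  dot k ≟E dot k′ with k ℕ.≟ k′
  ... | yes ≡.refl = yes ≡.refl
  ... | no k≢k′    = no (λ { ≡.refl → k≢k′ ≡.refl })

  _≟C_ : (α β : DComp) → Dec (α ≡ β)
  _≟C_ = List.≡-dec _≟E_

  weight-positive : ∀ e → 1 ≤ weight e
  weight-positive (pos k) = s≤s z≤n
  weight-positive (dot k) = s≤s z≤n

  weightC-∷-positive : ∀ e α → 1 ≤ weightC (e ∷ α)
  weightC-∷-positive e α = ℕ.≤-trans (weight-positive e) (ℕ.m≤m+n _ _)

  weightC-++ : ∀ α β → weightC (α ++ β) ≡ weightC α ℕ.+ weightC β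
  weightC-++ []      β = ≡.refl
  weightC-++ (e ∷ α) β = ≡.trans (≡.cong (weight e ℕ.+_) (weightC-++ α β)) (≡.sym (ℕ.+-assoc (weight e) _ _))

  weightC-take+drop : ∀ k α → weightC (take k α) ℕ.+ weightC (drop k α) ≡ weightC α
  weightC-take+drop k α = ≡.trans (≡.sym (weightC-++ (take k α) (drop k α))) (≡.cong weightC (List.take++drop≡id k α))

  weightC-take : ∀ k α → weightC (take k α) ≤ weightC α
  weightC-take k α = ≡.subst (weightC (take k α) ≤_) (weightC-take+drop k α) (ℕ.m≤m+n _ _)

  weightC-drop : ∀ k α → weightC (drop k α) ≤ weightC α
  weightC-drop k α = ≡.subst (weightC (drop k α) ≤_) (weightC-take+drop k α) (ℕ.m≤n+m _ _)

  take-length-++ : ∀ {x} {X : Set x} (xs ys : List X) → take (length xs) (xs ++ ys) ≡ xs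
  take-length-++ []       ys = ≡.refl
  take-length-++ (x ∷ xs) ys = ≡.cong (x ∷_) (take-length-++ xs ys)

  drop-length-++ : ∀ {x} {X : Set x} (xs ys : List X) → drop (length xs) (xs ++ ys) ≡ ys
  drop-length-++ []       ys = ≡.refl
  drop-length-++ (x ∷ xs) ys = drop-length-++ xs ys

  comps≤-bounded : ∀ D → All (λ α → weightC α ≤ D) (comps≤ D)
  comps≤-bounded zero    = z≤n ∷ []
  comps≤-bounded (suc D) = z≤n ∷ All.concat⁺ (All.map⁺ {xs = entries≤ (suc D)}
    (All.tabulate (λ {e} _ → All.all-filter (λ α → weightC α ≤? suc D) (map (e ∷_) (comps≤ D)))))

module BilinearForms {c ℓ} (K : Field c ℓ) where
  open Field K
  open Super K
  open Sums commutativeRing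

  record Bilinear {v ℓv w ℓw} (V : RawVS v ℓv) (W : RawVS w ℓw)
                  (φ : RawVS.Carrier V → RawVS.Carrier W → Carrier) : Set (ℓ ⊔ c ⊔ v ⊔ ℓv ⊔ w ⊔ ℓw) where
    field
      φ-cong   : ∀ {v v′ w w′} → RawVS._≈_ V v v′ → RawVS._≈_ W w w′ → φ v w ≈ φ v′ w′
      φ-+ˡ     : ∀ v v′ w → φ (RawVS._+_ V v v′) w ≈ φ v w + φ v′ w
      φ-+ʳ     : ∀ v w w′ → φ v (RawVS._+_ W w w′) ≈ φ v w + φ v w′
      φ-·      : ∀ k v w → φ (RawVS._·_ V k v) w ≈ φ v (RawVS._·_ W k w)
      φ-zeroˡ  : ∀ w → φ (RawVS.0v V) w ≈ 0#

  ∑⊗-resp : ∀ {v ℓv w ℓw} {V : RawVS v ℓv} {W : RawVS w ℓw} {φ} → Bilinear V W φ →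
            ∀ {t u} → TensorOps._≈⊗_ V W t u → ∑⊗ t φ ≈ ∑⊗ u φ
  ∑⊗-resp bilinear = go
    where
      open Bilinear bilinear
      open TensorOps
      go : ∀ {t u} → TensorOps._≈⊗_ _ _ t u → ∑⊗ t _ ≈ ∑⊗ u _
      go ≈⊗-refl            = refl
      go (≈⊗-sym t≈u)       = sym (go t≈u)
      go (≈⊗-trans t≈u u≈w) = trans (go t≈u) (go u≈w)
      go (++-cong {t} {t′} {u} {u′} t≈ u≈) =
        trans (∑-++ t u _) (trans (+-cong (go t≈) (go u≈)) (sym (∑-++ t′ u′ _)))
      go (++-comm t u)      = trans (∑-++ t u _) (trans (+-comm _ _) (sym (∑-++ u t _)))
      go (pair-cong v≈ w≈)  = +-congʳ (φ-cong v≈ w≈)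
      go (addˡ v v′ w)      = trans (+-congʳ (φ-+ˡ v v′ w)) (trans (+-identityʳ _) (+-congˡ (sym (+-identityʳ _))))
      go (addʳ v w w′)      = trans (+-congʳ (φ-+ʳ v w w′)) (trans (+-identityʳ _) (+-congˡ (sym (+-identityʳ _))))
      go (scal k v w)       = +-congʳ (φ-· k v w)
      go (zeroˡ w)          = trans (+-identityʳ _) (φ-zeroˡ w)

  ∑⊗-⊗ᶠ : ∀ {x y x′ y′} {X : Set x} {Y : Set y} {X′ : Set x′} {Y′ : Set y′}
          (F : X → X′) (G : Y → Y′) (t : List (X × Y)) φ → ∑⊗ ((F ⊗ᶠ G) t) φ ≈ ∑⊗ t (λ v w → φ (F v) (G w))
  ∑⊗-⊗ᶠ F G t φ = ∑-map _ t _

module SQSym {c ℓ} (K : Field c ℓ) where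
  open Field K
  open Super K
  open Sums commutativeRing
  open BilinearForms K
  open Compositions
  open import Algebra.Properties.CommutativeSemigroup *-commutativeSemigroup using (x∙yz≈y∙xz)
  open import Data.List.Relation.Unary.All using (All; []; _∷_)
  import Data.List.Relation.Unary.All as All
  import Data.List.Relation.Unary.All.Properties as All
  open import Relation.Binary.Reasoning.Setoid setoid
  import Data.Vec as Vec

  M-at : ∀ α m → M α m ≈ when (compress m ≟M monoα α) 1#
  M-at α m with compress m ≟M monoα α
  ... | yes _ = refl
  ... | no  _ = refl

  M-resp-compress : ∀ α m m′ → compress m ≡ compress m′ → M α m ≈ M α m′
  M-resp-compress α m m′ eq = trans (M-at α m)
    (trans (reflexive (≡.cong (λ w → when (w ≟M monoα α) 1#) eq)) (sym (M-at α m′)))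

  M-at-composition : ∀ α m → M α m ≈ when (compositionOf m ≟C α) 1#
  M-at-composition α m = trans (M-at α m) (when-⇔ (compress m ≟M monoα α) (compositionOf m ≟C α) 1#
    (λ eq → monoα-injective (≡.trans (≡.sym (compress≡monoα-compositionOf m)) eq))
    (λ eq → ≡.trans (compress≡monoα-compositionOf m) (≡.cong monoα eq)))

  M-monoα : ∀ α β → M α (monoα β) ≈ when (β ≟C α) 1#
  M-monoα α β = trans (M-at-composition α (monoα β)) (when-⇔ (compositionOf (monoα β) ≟C α) (β ≟C α) 1#
    (≡.trans (≡.sym (compositionOf-monoα β))) (≡.trans (compositionOf-monoα β)))

  M-bounded : ∀ α → BoundedBy (weightC α) (M α)
  M-bounded α m wα<m = trans (M-at α m) (when-no (compress m ≟M monoα α) 1# λ eq →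
    ℕ.<-irrefl (≡.trans (≡.sym (degM-monoα α)) (≡.trans (≡.cong degM (≡.sym eq)) (degM-compress m))) wα<m)

  M-∈sQSym : ∀ α → InSQSym (M α)
  M-∈sQSym α = ((λ m → M-resp-compress α (m ++ [ absent ]) m (compress-++-absent m)) , weightC α , M-bounded α)
             , (λ β is js → M-resp-compress α (monoAt β is) (monoAt β js)
                              (≡.trans (compress-monoAt β is) (≡.sym (compress-monoAt β js))))

  BoundedBy-mono : ∀ {D E f} → D ≤ E → BoundedBy D f → BoundedBy E f
  BoundedBy-mono D≤E bounded m E<m = bounded m (ℕ.≤-<-trans D≤E E<m)

  0S-∈sQSym : InSQSym 0S
  0S-∈sQSym = ((λ m → refl) , 0 , (λ m _ → refl)) , (λ α is js → refl)

  ·S-∈sQSym : ∀ k {f} → InSQSym f → InSQSym (k ·S f)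
  ·S-∈sQSym k ((trailing , D , bounded) , qsym) =
    ((λ m → *-congˡ (trailing m)) , D , (λ m D<m → trans (*-congˡ (bounded m D<m)) (zeroʳ k)))
    , (λ α is js → *-congˡ (qsym α is js))

  +S-∈sQSym : ∀ {f g} → InSQSym f → InSQSym g → InSQSym (f +S g)
  +S-∈sQSym ((trailing , D , bounded) , qsym) ((trailing′ , D′ , bounded′) , qsym′) =
    ((λ m → +-cong (trailing m) (trailing′ m)) , D ℕ.⊔ D′ ,
     (λ m D⊔D′<m → trans (+-cong (BoundedBy-mono (ℕ.m≤m⊔n D D′) bounded m D⊔D′<m)
                                  (BoundedBy-mono (ℕ.m≤n⊔m D D′) bounded′ m D⊔D′<m)) (+-identityʳ 0#)))
    , (λ α is js → +-cong (qsym α is js) (qsym′ α is js))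

  sumS : ∀ {x} {X : Set x} → List X → (X → Series) → Series
  sumS xs F = foldr _+S_ 0S (map F xs)

  sumS-at : ∀ {x} {X : Set x} (xs : List X) F m → sumS xs F m ≡ ∑ xs (λ x → F x m)
  sumS-at []       F m = ≡.refl
  sumS-at (x ∷ xs) F m = ≡.cong (F x m +_) (sumS-at xs F m)

  sumS-∈sQSym : ∀ {x} {X : Set x} (xs : List X) F → (∀ x → InSQSym (F x)) → InSQSym (sumS xs F)
  sumS-∈sQSym []       F F∈ = 0S-∈sQSym
  sumS-∈sQSym (x ∷ xs) F F∈ = +S-∈sQSym (F∈ x) (sumS-∈sQSym xs F F∈)

  Trailing-replicate : ∀ {f} → Trailing f → ∀ m t → f (m ++ replicate t absent) ≈ f m
  Trailing-replicate {f} trailing m zero    = reflexive (≡.cong f (List.++-identityʳ m))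
  Trailing-replicate {f} trailing m (suc t) = begin
    f (m ++ absent ∷ replicate t absent)         ≡⟨ ≡.cong f (≡.sym (List.++-assoc m [ absent ] _)) ⟩
    f ((m ++ [ absent ]) ++ replicate t absent)  ≈⟨ Trailing-replicate trailing (m ++ [ absent ]) t ⟩
    f (m ++ [ absent ])                          ≈⟨ trailing m ⟩
    f m                                          ∎

  normal-form : ∀ {f} → InSQSym f → ∀ m → f m ≈ f (monoα (compositionOf m))
  normal-form {f} ((trailing , _) , qsym) m with gap-decomposition m
  ... | gs , t , m≡ = begin
    f m                                        ≡⟨ ≡.cong f m≡ ⟩
    f (monoAt α gs ++ replicate t absent)      ≈⟨ Trailing-replicate trailing _ t ⟩
    f (monoAt α gs)                            ≈⟨ qsym α gs (Vec.replicate (length α) 0) ⟩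
    f (monoAt α (Vec.replicate (length α) 0))  ≡⟨ ≡.cong f (monoAt-adjacent α) ⟩
    f (monoα α)                                ∎
    where α = compositionOf m

  ∑-entries≤-delta : ∀ n e₀ (H : Entry → Carrier) → (∀ e → e ≢ e₀ → H e ≈ 0#) →
                     ∑ (entries≤ n) H ≈ when (weight e₀ ≤? n) (H e₀)
  ∑-entries≤-delta n e₀ H H≈0 = begin
    ∑ (entries≤ n) H                             ≈⟨ ∑-concatMap _ (upTo n) H ⟩
    ∑ (upTo n) pair                              ≈⟨ ∑-upTo n pair ⟩
    ∑< n pair                                    ≈⟨ ∑<-delta n pair (index e₀) (λ k _ k≢ → pair-off k k≢) ⟩
    when (index e₀ <? n) (pair (index e₀))       ≈⟨ when-cong (index e₀ <? n) (pair-at e₀ H≈0) ⟩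
    when (index e₀ <? n) (H e₀)                  ≈⟨ when-⇔ (index e₀ <? n) (weight e₀ ≤? n) (H e₀)
                                                      (≡.subst (_≤ n) (≡.sym (weight≡suc-index e₀)))
                                                      (≡.subst (_≤ n) (weight≡suc-index e₀)) ⟩
    when (weight e₀ ≤? n) (H e₀)                 ∎
    where
      index : Entry → ℕ
      index (pos k) = k
      index (dot k) = k
      weight≡suc-index : ∀ e → weight e ≡ suc (index e)
      weight≡suc-index (pos k) = ≡.refl
      weight≡suc-index (dot k) = ≡.refl
      pair : ℕ → Carrier
      pair k = H (pos k) + (H (dot k) + 0#)
      pair-off : ∀ k → k ≢ index e₀ → pair k ≈ 0#
      pair-off k k≢ = trans (+-cong (H≈0 (pos k) (k≢ ∘ ≡.cong index))
                                    (+-congʳ (H≈0 (dot k) (k≢ ∘ ≡.cong index))))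
                            (trans (+-identityˡ _) (+-identityˡ 0#))
      pair-at : ∀ e₀ → (∀ e → e ≢ e₀ → H e ≈ 0#) → pair (index e₀) ≈ H e₀
      pair-at (pos k) H≈0 = trans (+-congˡ (trans (+-congʳ (H≈0 (dot k) (λ ()))) (+-identityˡ 0#))) (+-identityʳ _)
      pair-at (dot k) H≈0 = trans (+-congʳ (H≈0 (pos k) (λ ()))) (trans (+-identityˡ _) (+-identityʳ _))

  ∑-comps≤-delta : ∀ D α₀ (G : DComp → Carrier) → (∀ α → α ≢ α₀ → G α ≈ 0#) →
                   ∑ (comps≤ D) G ≈ when (weightC α₀ ≤? D) (G α₀)
  ∑-comps≤-delta zero [] G G≈0 = +-identityʳ _
  ∑-comps≤-delta zero (e ∷ α) G G≈0 = trans (+-identityʳ _) (trans (G≈0 [] (λ ()))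
    (sym (when-no (weightC (e ∷ α) ≤? 0) _ (λ w≤0 → ℕ.≤⇒≯ w≤0 (weightC-∷-positive e α)))))
  ∑-comps≤-delta (suc D) α₀ G G≈0 = trans (+-congˡ by-first-entry) (split α₀ G≈0)
    where
      H : Entry → Carrier
      H e = ∑ (comps≤ D) (λ α → when (weightC (e ∷ α) ≤? suc D) (G (e ∷ α)))
      H≈0 : ∀ e → (∀ α → G (e ∷ α) ≈ 0#) → H e ≈ 0#
      H≈0 e G≈0 = ∑-zero (comps≤ D) (λ α →
        trans (when-cong (weightC (e ∷ α) ≤? suc D) (G≈0 α)) (when-zero (weightC (e ∷ α) ≤? suc D)))
      extensions : Entry → List DComp
      extensions e = filter (λ α → weightC α ≤? suc D) (map (e ∷_) (comps≤ D))
      by-first-entry : ∑ (concatMap extensions (entries≤ (suc D))) G ≈ ∑ (entries≤ (suc D)) H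
      by-first-entry = trans (∑-concatMap extensions (entries≤ (suc D)) G) (∑-cong (entries≤ (suc D)) (λ e →
        trans (∑-filter (λ α → weightC α ≤? suc D) (map (e ∷_) (comps≤ D)) G) (∑-map (e ∷_) (comps≤ D) _)))
      split : ∀ α₀ → (∀ α → α ≢ α₀ → G α ≈ 0#) →
              G [] + ∑ (entries≤ (suc D)) H ≈ when (weightC α₀ ≤? suc D) (G α₀)
      split [] G≈0 =
        trans (+-congˡ (∑-zero (entries≤ (suc D)) (λ e → H≈0 e (λ α → G≈0 (e ∷ α) (λ ()))))) (+-identityʳ _)
      split (e₀ ∷ α₁) G≈0 = begin
        G [] + ∑ (entries≤ (suc D)) H
          ≈⟨ trans (+-congʳ (G≈0 [] (λ ()))) (+-identityˡ _) ⟩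
        ∑ (entries≤ (suc D)) H
          ≈⟨ ∑-entries≤-delta (suc D) e₀ H (λ e e≢ → H≈0 e (λ α → G≈0 (e ∷ α) (e≢ ∘ List.∷-injectiveˡ))) ⟩
        when (weight e₀ ≤? suc D) (H e₀)
          ≈⟨ when-cong (weight e₀ ≤? suc D) (∑-comps≤-delta D α₁ _ (λ α α≢ →
               trans (when-cong (weightC (e₀ ∷ α) ≤? suc D) (G≈0 (e₀ ∷ α) (α≢ ∘ List.∷-injectiveʳ)))
                     (when-zero (weightC (e₀ ∷ α) ≤? suc D)))) ⟩
        when (weight e₀ ≤? suc D) (when (weightC α₁ ≤? D) (when (weightC (e₀ ∷ α₁) ≤? suc D) (G (e₀ ∷ α₁))))
          ≈⟨ nested (weight e₀ ≤? suc D) (weightC α₁ ≤? D) (weightC (e₀ ∷ α₁) ≤? suc D) ⟩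
        when (weightC (e₀ ∷ α₁) ≤? suc D) (G (e₀ ∷ α₁)) ∎
        where
          nested : ∀ (d₁ : Dec (weight e₀ ≤ suc D)) (d₂ : Dec (weightC α₁ ≤ D)) d₃ →
                   when d₁ (when d₂ (when d₃ (G (e₀ ∷ α₁)))) ≈ when d₃ (G (e₀ ∷ α₁))
          nested d₁ d₂ (yes w≤) = trans (when-yes d₁ _ (ℕ.≤-trans (ℕ.m≤m+n (weight e₀) _) w≤))
            (when-yes d₂ _ (ℕ.≤-pred (ℕ.≤-trans (ℕ.+-monoˡ-≤ (weightC α₁) (weight-positive e₀)) w≤)))
          nested d₁ d₂ (no _) = trans (when-cong d₁ (when-zero d₂)) (when-zero d₁)

  when-bounded : ∀ {E f} → BoundedBy E f → ∀ m {w} → w ≡ degM m → (d : Dec (w ≤ E)) → when d (f m) ≈ f m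
  when-bounded bounded m w≡ (yes _)  = refl
  when-bounded bounded m w≡ (no w≰E) = sym (bounded m (≡.subst (_ <_) w≡ (ℕ.≰⇒> w≰E)))

  M-expansion : ∀ {f} E → InSQSym f → BoundedBy E f → f ≈S sumS (comps≤ E) (λ β → coeffM β f ·S M β)
  M-expansion {f} E f∈ bounded m = sym (begin
    sumS (comps≤ E) (λ β → coeffM β f ·S M β) m
      ≡⟨ sumS-at (comps≤ E) _ m ⟩
    ∑ (comps≤ E) (λ β → coeffM β f * M β m)
      ≈⟨ ∑-comps≤-delta E α _ (λ β β≢α → trans (*-congˡ (trans (M-at-composition β m)
           (when-no (α ≟C β) 1# (β≢α ∘ ≡.sym)))) (zeroʳ _)) ⟩
    when (weightC α ≤? E) (coeffM α f * M α m)
      ≈⟨ when-cong (weightC α ≤? E) (trans (*-congˡ (trans (M-at-composition α m) (when-yes (α ≟C α) 1# ≡.refl)))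
           (trans (*-identityʳ _) (sym (normal-form f∈ m)))) ⟩
    when (weightC α ≤? E) (f m)
      ≈⟨ when-bounded bounded m (≡.sym (degM≡weightC-compositionOf m)) (weightC α ≤? E) ⟩
    f m ∎)
    where α = compositionOf m

  when-1# : ∀ {p} {P : Set p} (d : Dec P) k → k * when d 1# ≈ when d k
  when-1# (yes _) k = *-identityʳ k
  when-1# (no _)  k = zeroʳ k

  ∑-cuts : ∀ β γ α v → ∑< (suc (length α)) (λ k → when (γ ≟C drop k α) (when (β ≟C take k α) v))
                       ≈ when (β ++ γ ≟C α) v
  ∑-cuts β γ α v = cases α (β ++ γ ≟C α)
    where
      cases : ∀ α (d : Dec (β ++ γ ≡ α)) →
              ∑< (suc (length α)) (λ k → when (γ ≟C drop k α) (when (β ≟C take k α) v)) ≈ when d v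
      cases α (no α≢) = ∑<-zero (suc (length α)) (λ k _ → off k)
        where
          off : ∀ k → when (γ ≟C drop k α) (when (β ≟C take k α) v) ≈ 0#
          off k with γ ≟C drop k α | β ≟C take k α
          ... | yes γ≡ | yes β≡ =
            ⊥-elim (α≢ (≡.sym (≡.trans (≡.sym (List.take++drop≡id k α)) (≡.cong₂ _++_ (≡.sym β≡) (≡.sym γ≡)))))
          ... | yes _  | no _   = refl
          ... | no _   | _      = refl
      cases .(β ++ γ) (yes ≡.refl) = begin
        ∑< (suc (length (β ++ γ))) (λ k → when (γ ≟C drop k (β ++ γ)) (when (β ≟C take k (β ++ γ)) v))
          ≈⟨ ∑<-delta (suc (length (β ++ γ))) _ (length β) (λ k k≤ k≢ →
               trans (when-cong (γ ≟C drop k (β ++ γ))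
                                (when-no (β ≟C take k (β ++ γ)) v (λ β≡ → k≢ (length-cut k (ℕ.≤-pred k≤) β≡))))
                     (when-zero (γ ≟C drop k (β ++ γ)))) ⟩
        when (length β <? suc (length (β ++ γ)))
             (when (γ ≟C drop (length β) (β ++ γ)) (when (β ≟C take (length β) (β ++ γ)) v))
          ≈⟨ when-yes (length β <? _) _ (s≤s (List.length-++-≤ˡ β)) ⟩
        when (γ ≟C drop (length β) (β ++ γ)) (when (β ≟C take (length β) (β ++ γ)) v)
          ≈⟨ trans (when-yes (γ ≟C _) _ (≡.sym (drop-length-++ β γ)))
                   (when-yes (β ≟C _) _ (≡.sym (take-length-++ β γ))) ⟩
        v ∎
        where
          length-cut : ∀ k → k ≤ length (β ++ γ) → β ≡ take k (β ++ γ) → k ≡ length β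
          length-cut k k≤ β≡ = ≡.sym (≡.trans (≡.cong length β≡)
            (≡.trans (List.length-take k (β ++ γ)) (ℕ.m≤n⇒m⊓n≡m k≤)))

  coefficient : DComp → DComp → S⊗S → Carrier
  coefficient β γ t = ∑⊗ t (λ g h → coeffM β g * coeffM γ h)

  ΔQ-coefficient : ∀ {f} D β γ → BoundedBy D f → coefficient β γ (ΔQ D f) ≈ f (monoα β ++ monoα γ)
  ΔQ-coefficient {f} D β γ bounded = begin
    coefficient β γ (ΔQ D f)
      ≈⟨ ∑-concatMap _ (comps≤ D) _ ⟩
    ∑ (comps≤ D) (λ α → ∑ (map _ (upTo (suc (length α)))) _)
      ≈⟨ ∑-cong (comps≤ D) (λ α → trans (∑-map _ (upTo (suc (length α))) _)
           (trans (∑-upTo (suc (length α)) _) (trans (∑<-cong (suc (length α)) (λ k _ → cut-term α k))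
                  (∑-cuts β γ α (coeffM α f))))) ⟩
    ∑ (comps≤ D) (λ α → when (β ++ γ ≟C α) (coeffM α f))
      ≈⟨ ∑-comps≤-delta D (β ++ γ) _ (λ α α≢ → when-no (β ++ γ ≟C α) _ (α≢ ∘ ≡.sym)) ⟩
    when (weightC (β ++ γ) ≤? D) (when (β ++ γ ≟C β ++ γ) (f (monoα (β ++ γ))))
      ≈⟨ when-cong (weightC (β ++ γ) ≤? D) (when-yes (β ++ γ ≟C β ++ γ) _ ≡.refl) ⟩
    when (weightC (β ++ γ) ≤? D) (f (monoα (β ++ γ)))
      ≡⟨ ≡.cong (when (weightC (β ++ γ) ≤? D)) (≡.cong f (List.map-++ entryM β γ)) ⟩
    when (weightC (β ++ γ) ≤? D) (f (monoα β ++ monoα γ))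
      ≈⟨ when-bounded bounded _ weight≡ (weightC (β ++ γ) ≤? D) ⟩
    f (monoα β ++ monoα γ) ∎
    where
      weight≡ : weightC (β ++ γ) ≡ degM (monoα β ++ monoα γ)
      weight≡ = ≡.trans (≡.sym (degM-monoα (β ++ γ))) (≡.cong degM (List.map-++ entryM β γ))
      cut-term : ∀ α k → (coeffM α f * M (take k α) (monoα β)) * M (drop k α) (monoα γ)
                         ≈ when (γ ≟C drop k α) (when (β ≟C take k α) (coeffM α f))
      cut-term α k = begin
        (coeffM α f * M (take k α) (monoα β)) * M (drop k α) (monoα γ)
          ≈⟨ *-cong (*-congˡ (M-monoα (take k α) β)) (M-monoα (drop k α) γ) ⟩
        (coeffM α f * when (β ≟C take k α) 1#) * when (γ ≟C drop k α) 1#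
          ≈⟨ trans (*-congʳ (when-1# (β ≟C take k α) _)) (when-1# (γ ≟C drop k α) _) ⟩
        when (γ ≟C drop k α) (when (β ≟C take k α) (coeffM α f)) ∎

  InSQSym≤ : ℕ → Series → Set ℓ
  InSQSym≤ E f = InSQSym f × BoundedBy E f

  InSQSym⊗≤ : ℕ → S⊗S → Set (c ⊔ ℓ)
  InSQSym⊗≤ E = All (λ p → InSQSym≤ E (proj₁ p) × InSQSym≤ E (proj₂ p))

  M-∈sQSym≤ : ∀ {α E} → weightC α ≤ E → InSQSym≤ E (M α)
  M-∈sQSym≤ {α} α≤E = M-∈sQSym α , BoundedBy-mono α≤E (M-bounded α)

  ·S-∈sQSym≤ : ∀ {E f} k → InSQSym≤ E f → InSQSym≤ E (k ·S f)
  ·S-∈sQSym≤ k (f∈ , f≤) = ·S-∈sQSym k f∈ , (λ m E<m → trans (*-congˡ (f≤ m E<m)) (zeroʳ k))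

  module T = TensorOps seriesVS seriesVS

  ≡⇒≈SS : ∀ {t u} → t ≡ u → t ≈SS u
  ≡⇒≈SS ≡.refl = T.≈⊗-refl

  concatMap-cong : ∀ {x} {X : Set x} (xs : List X) {F G : X → S⊗S} → (∀ x → F x ≈SS G x) →
                   concatMap F xs ≈SS concatMap G xs
  concatMap-cong []       F≈G = T.≈⊗-refl
  concatMap-cong (x ∷ xs) F≈G = T.++-cong (F≈G x) (concatMap-cong xs F≈G)

  concatMap-zero : ∀ {x} {X : Set x} (xs : List X) {F : X → S⊗S} → (∀ x → F x ≈SS []) → concatMap F xs ≈SS []
  concatMap-zero []       F≈0 = T.≈⊗-refl
  concatMap-zero (x ∷ xs) F≈0 = T.++-cong (F≈0 x) (concatMap-zero xs F≈0)

  ++-interchange : ∀ (a b c d : S⊗S) → (a ++ b) ++ (c ++ d) ≈SS (a ++ c) ++ (b ++ d)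
  ++-interchange a b c d = T.≈⊗-trans (≡⇒≈SS (List.++-assoc a b (c ++ d)))
    (T.≈⊗-trans (T.++-cong {t = a} T.≈⊗-refl (T.≈⊗-trans (≡⇒≈SS (≡.sym (List.++-assoc b c d)))
      (T.≈⊗-trans (T.++-cong (T.++-comm b c) (T.≈⊗-refl {t = d})) (≡⇒≈SS (List.++-assoc c b d)))))
    (≡⇒≈SS (≡.sym (List.++-assoc a c (b ++ d)))))

  concatMap-++ : ∀ {x} {X : Set x} (xs : List X) (F G : X → S⊗S) →
                 concatMap F xs ++ concatMap G xs ≈SS concatMap (λ x → F x ++ G x) xs
  concatMap-++ []       F G = T.≈⊗-refl
  concatMap-++ (x ∷ xs) F G = T.≈⊗-trans (++-interchange (F x) _ (G x) _)
    (T.++-cong (T.≈⊗-refl {t = F x ++ G x}) (concatMap-++ xs F G))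

  ⊗-zeroʳ : ∀ f → [ (f , 0S) ] ≈SS []
  ⊗-zeroʳ f = T.≈⊗-trans (T.pair-cong {v = f} (λ _ → refl) (λ _ → sym (zeroˡ 0#)))
    (T.≈⊗-trans (T.≈⊗-sym (T.scal 0# f 0S))
    (T.≈⊗-trans (T.pair-cong (λ m → zeroˡ (f m)) (λ _ → refl)) (T.zeroˡ 0S)))

  ⊗-sumˡ : ∀ {x} {X : Set x} (xs : List X) F g → [ (sumS xs F , g) ] ≈SS concatMap (λ x → [ (F x , g) ]) xs
  ⊗-sumˡ []       F g = T.zeroˡ g
  ⊗-sumˡ (x ∷ xs) F g =
    T.≈⊗-trans (T.addˡ (F x) (sumS xs F) g) (T.++-cong {t = [ (F x , g) ]} T.≈⊗-refl (⊗-sumˡ xs F g))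

  ⊗-sumʳ : ∀ {x} {X : Set x} (xs : List X) F f → [ (f , sumS xs F) ] ≈SS concatMap (λ x → [ (f , F x) ]) xs
  ⊗-sumʳ []       F f = ⊗-zeroʳ f
  ⊗-sumʳ (x ∷ xs) F f =
    T.≈⊗-trans (T.addʳ f (F x) (sumS xs F)) (T.++-cong {t = [ (f , F x) ]} T.≈⊗-refl (⊗-sumʳ xs F f))

  coefficient-bilinear : ∀ β γ → Bilinear seriesVS seriesVS (λ g h → coeffM β g * coeffM γ h)
  coefficient-bilinear β γ = record
    { φ-cong  = λ g≈ h≈ → *-cong (g≈ _) (h≈ _)
    ; φ-+ˡ    = λ g g′ h → distribʳ _ _ _
    ; φ-+ʳ    = λ g h h′ → distribˡ _ _ _
    ; φ-·     = λ k g h → trans (*-assoc k _ _) (x∙yz≈y∙xz k _ _)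
    ; φ-zeroˡ = λ h → zeroˡ _ }

  canonical : ℕ → (DComp → DComp → Carrier) → S⊗S
  canonical E c = concatMap (λ β → concatMap (λ γ → [ (c β γ ·S M β , M γ) ]) (comps≤ E)) (comps≤ E)

  canonical-cong : ∀ E {c c′} → (∀ β γ → c β γ ≈ c′ β γ) → canonical E c ≈SS canonical E c′
  canonical-cong E c≈c′ = concatMap-cong (comps≤ E) (λ β → concatMap-cong (comps≤ E) (λ γ →
    T.pair-cong (λ m → *-congʳ (c≈c′ β γ)) (λ _ → refl)))

  canonical-zero : ∀ E → canonical E (λ _ _ → 0#) ≈SS []
  canonical-zero E = concatMap-zero (comps≤ E) (λ β → concatMap-zero (comps≤ E) (λ γ →
    T.≈⊗-trans (T.pair-cong (λ m → zeroˡ (M β m)) (λ _ → refl)) (T.zeroˡ (M γ))))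

  canonical-+ : ∀ E c c′ → canonical E c ++ canonical E c′ ≈SS canonical E (λ β γ → c β γ + c′ β γ)
  canonical-+ E c c′ = T.≈⊗-trans (concatMap-++ (comps≤ E) _ _) (concatMap-cong (comps≤ E) (λ β →
    T.≈⊗-trans (concatMap-++ (comps≤ E) _ _) (concatMap-cong (comps≤ E) (λ γ →
      T.≈⊗-trans (T.≈⊗-sym (T.addˡ _ _ (M γ))) (T.pair-cong (λ m → sym (distribʳ (M β m) _ _)) (λ _ → refl))))))

  pure-canonical : ∀ E {f g} → InSQSym≤ E f → InSQSym≤ E g →
                   [ (f , g) ] ≈SS canonical E (λ β γ → coeffM β f * coeffM γ g)
  pure-canonical E {f} {g} (f∈ , f≤) (g∈ , g≤) =
    T.≈⊗-trans (T.pair-cong (M-expansion E f∈ f≤) (M-expansion E g∈ g≤))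
    (T.≈⊗-trans (⊗-sumˡ (comps≤ E) (λ β → coeffM β f ·S M β) _)
    (concatMap-cong (comps≤ E) (λ β → T.≈⊗-trans (⊗-sumʳ (comps≤ E) (λ γ → coeffM γ g ·S M γ) _)
      (concatMap-cong (comps≤ E) (λ γ → T.≈⊗-trans (T.≈⊗-sym (T.scal (coeffM γ g) (coeffM β f ·S M β) (M γ)))
        (T.pair-cong (λ m → trans (sym (*-assoc _ _ _)) (*-congʳ (*-comm _ _))) (λ _ → refl)))))))

  canonical-form : ∀ E t → InSQSym⊗≤ E t → t ≈SS canonical E (λ β γ → coefficient β γ t)
  canonical-form E []            []                = T.≈⊗-sym (canonical-zero E)
  canonical-form E ((f , g) ∷ t) ((f∈ , g∈) ∷ t∈) = T.≈⊗-trans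
    (T.++-cong {t = [ (f , g) ]} (pure-canonical E f∈ g∈) (canonical-form E t t∈)) (canonical-+ E _ _)

  tensor-ext : ∀ E {t u} → InSQSym⊗≤ E t → InSQSym⊗≤ E u →
               (∀ β γ → coefficient β γ t ≈ coefficient β γ u) → t ≈SS u
  tensor-ext E {t} {u} t∈ u∈ t≈u = T.≈⊗-trans (canonical-form E t t∈)
    (T.≈⊗-trans (canonical-cong E t≈u) (T.≈⊗-sym (canonical-form E u u∈)))

  ΔQ-∈sQSym⊗≤ : ∀ f {D E} → D ≤ E → InSQSym⊗≤ E (ΔQ D f)
  ΔQ-∈sQSym⊗≤ f {D} D≤E = All.concat⁺ (All.map⁺ {xs = comps≤ D} (All.map (λ {α} α≤D →
    All.map⁺ (All.applyUpTo⁺₂ (λ k → k) (suc (length α)) (λ k →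
        ·S-∈sQSym≤ (coeffM α f) (M-∈sQSym≤ (ℕ.≤-trans (weightC-take k α) (ℕ.≤-trans α≤D D≤E)))
      , M-∈sQSym≤ (ℕ.≤-trans (weightC-drop k α) (ℕ.≤-trans α≤D D≤E)))))
    (comps≤-bounded D)))

  sign : Bool → Carrier
  sign s = if s then - 1# else 1#

  *S-distribʳ-+S : ∀ f f′ g → (f +S f′) *S g ≈S (f *S g) +S (f′ *S g)
  *S-distribʳ-+S f f′ g m = trans (∑-cong (splits m) (λ t → trans (*-congˡ (distribʳ _ _ _)) (distribˡ _ _ _)))
                                  (∑-distrib-+ (splits m) _ _)

  *S-distribˡ-+S : ∀ f g g′ → f *S (g +S g′) ≈S (f *S g) +S (f *S g′)
  *S-distribˡ-+S f g g′ m = trans (∑-cong (splits m) (λ t → trans (*-congˡ (distribˡ _ _ _)) (distribˡ _ _ _)))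
                                  (∑-distrib-+ (splits m) _ _)

  0S-*S : ∀ g → 0S *S g ≈S 0S
  0S-*S g m = ∑-zero (splits m) (λ t → trans (*-congˡ (zeroˡ _)) (zeroʳ _))

  *S-cong : ∀ {f f′ g g′} → f ≈S f′ → g ≈S g′ → f *S g ≈S f′ *S g′
  *S-cong f≈f′ g≈g′ m = ∑-cong (splits m) (λ t → *-congˡ (*-cong (f≈f′ _) (g≈g′ _)))

  *S-sumS : ∀ {x y} {X : Set x} {Y : Set y} (xs : List X) (ys : List Y) F G →
            sumS xs F *S sumS ys G ≈S (λ m → ∑ xs (λ x → ∑ ys (λ y → (F x *S G y) m)))
  *S-sumS xs ys F G m = begin
    ∑ (splits m) (λ t → sign (s t) * (sumS xs F (m₁ t) * sumS ys G (m₂ t)))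
      ≈⟨ ∑-cong (splits m) (λ t → *-congˡ (trans (*-cong (reflexive (sumS-at xs F _)) (reflexive (sumS-at ys G _)))
           (∑-*-∑ xs ys _ _))) ⟩
    ∑ (splits m) (λ t → sign (s t) * ∑ xs (λ x → ∑ ys (λ y → F x (m₁ t) * G y (m₂ t))))
      ≈⟨ ∑-cong (splits m) (λ t → trans (*-distribˡ-∑ _ xs _) (∑-cong xs (λ x → *-distribˡ-∑ _ ys _))) ⟩
    ∑ (splits m) (λ t → ∑ xs (λ x → ∑ ys (λ y → sign (s t) * (F x (m₁ t) * G y (m₂ t)))))
      ≈⟨ ∑-comm (splits m) xs _ ⟩
    ∑ xs (λ x → ∑ (splits m) (λ t → ∑ ys (λ y → sign (s t) * (F x (m₁ t) * G y (m₂ t)))))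
      ≈⟨ ∑-cong xs (λ x → ∑-comm (splits m) ys _) ⟩
    ∑ xs (λ x → ∑ ys (λ y → (F x *S G y) m)) ∎
    where
      m₁ m₂ : Monomial × Monomial × Bool → Monomial
      m₁ = proj₁
      m₂ t = proj₁ (proj₂ t)
      s : Monomial × Monomial × Bool → Bool
      s t = proj₂ (proj₂ t)

  ·S-*S : ∀ k f g → (k ·S f) *S g ≈S k ·S (f *S g)
  ·S-*S k f g m = trans (∑-cong (splits m) (λ t → trans (*-congˡ (*-assoc k _ _)) (x∙yz≈y∙xz _ k _)))
                        (sym (*-distribˡ-∑ k (splits m) _))

  *S-·S : ∀ k f g → f *S (k ·S g) ≈S k ·S (f *S g)
  *S-·S k f g m = trans (∑-cong (splits m) (λ t → trans (*-congˡ (x∙yz≈y∙xz _ k _)) (x∙yz≈y∙xz _ k _)))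
                        (sym (*-distribˡ-∑ k (splits m) _))

  1S-[] : 1S [] ≈ 1#
  1S-[] = trans (M-at [] []) (when-yes ([] ≟M []) 1# ≡.refl)

  1S-absent∷ : ∀ m → 1S (absent ∷ m) ≈ 1S m
  1S-absent∷ m = M-resp-compress [] (absent ∷ m) m ≡.refl

  1S-present∷ : ∀ h m → h ≢ absent → 1S (h ∷ m) ≈ 0#
  1S-present∷ h m h≢ =
    trans (M-at-composition [] (h ∷ m)) (when-no (compositionOf (h ∷ m) ≟C []) 1# (nonempty h h≢))
    where
      nonempty : ∀ h → h ≢ absent → compositionOf (h ∷ m) ≢ []
      nonempty (zero , false)  h≢ _ = h≢ ≡.refl
      nonempty (suc k , false) h≢ ()
      nonempty (k , true)      h≢ ()

  -- In f *S 1S only the splitting that gives f the whole exponent of the first variable survives.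
  ∑-head-into-left : ∀ k e (F : ℕ → Carrier) m₂ →
                     ∑< (suc e) (λ a → k * (F a * 1S ((e ∸ a , false) ∷ m₂))) ≈ k * (F e * 1S m₂)
  ∑-head-into-left k e F m₂ = begin
    ∑< (suc e) (λ a → k * (F a * 1S ((e ∸ a , false) ∷ m₂)))
      ≈⟨ ∑<-delta (suc e) (λ a → k * (F a * 1S ((e ∸ a , false) ∷ m₂))) e (λ a a≤e a≢e →
           trans (*-congˡ (trans (*-congˡ (1S-present∷ (e ∸ a , false) m₂
           (λ eq → a≢e (ℕ.≤-antisym (ℕ.≤-pred a≤e) (ℕ.m∸n≡0⇒m≤n (≡.cong proj₁ eq)))))) (zeroʳ _))) (zeroʳ k)) ⟩
    when (e <? suc e) (k * (F e * 1S ((e ∸ e , false) ∷ m₂)))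
      ≈⟨ when-yes (e <? suc e) _ (ℕ.n<1+n e) ⟩
    k * (F e * 1S ((e ∸ e , false) ∷ m₂))
      ≡⟨ ≡.cong (λ d → k * (F e * 1S ((d , false) ∷ m₂))) (ℕ.n∸n≡0 e) ⟩
    k * (F e * 1S (absent ∷ m₂))
      ≈⟨ *-congˡ (*-congˡ (1S-absent∷ m₂)) ⟩
    k * (F e * 1S m₂) ∎

  *S-identityʳ : ∀ f → f *S 1S ≈S f
  *S-identityʳ f [] = trans (+-identityʳ _) (trans (*-identityˡ _) (trans (*-congˡ 1S-[]) (*-identityʳ _)))
  *S-identityʳ f ((e , false) ∷ m) = begin
    (f *S 1S) ((e , false) ∷ m)
      ≈⟨ ∑-concatMap _ (splits m) _ ⟩
    ∑ (splits m) (λ t → ∑ (map _ (upTo (suc e))) _)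
      ≈⟨ ∑-cong (splits m) (λ t → trans (∑-map _ (upTo (suc e)) _) (trans (∑-upTo (suc e) _)
           (∑-head-into-left _ e (λ a → f ((a , false) ∷ proj₁ t)) _))) ⟩
    ((λ m′ → f ((e , false) ∷ m′)) *S 1S) m
      ≈⟨ *S-identityʳ (λ m′ → f ((e , false) ∷ m′)) m ⟩
    f ((e , false) ∷ m) ∎
  *S-identityʳ f ((e , true) ∷ m) = begin
    (f *S 1S) ((e , true) ∷ m)
      ≈⟨ ∑-concatMap _ (splits m) _ ⟩
    ∑ (splits m) (λ t → ∑ (map _ (upTo (suc e)) ++ map _ (upTo (suc e))) _)
      ≈⟨ ∑-cong (splits m) (λ t → trans (∑-++ (map _ (upTo (suc e))) _ _) (trans (+-cong
           (trans (∑-map _ (upTo (suc e)) _) (trans (∑-upTo (suc e) _)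
             (∑-head-into-left _ e (λ a → f ((a , true) ∷ proj₁ t)) _)))
           (trans (∑-map _ (upTo (suc e)) _) (∑-zero (upTo (suc e)) (λ a →
             trans (*-congˡ (trans (*-congˡ (1S-present∷ (e ∸ a , true) _ λ ())) (zeroʳ _))) (zeroʳ _)))))
           (+-identityʳ _))) ⟩
    ((λ m′ → f ((e , true) ∷ m′)) *S 1S) m
      ≈⟨ *S-identityʳ (λ m′ → f ((e , true) ∷ m′)) m ⟩
    f ((e , true) ∷ m) ∎

  parS-at : ∀ p f m → parS p f m ≈ when (parM m ≟P p) (f m)
  parS-at p f m with parM m ≟P p
  ... | yes _ = refl
  ... | no  _ = refl

  degS-at : ∀ n f m → degS n f m ≈ when (degM m ℕ.≟ n) (f m)
  degS-at n f m with degM m ℕ.≟ n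
  ... | yes m≡n = sym (when-yes (degM m ℕ.≟ n) _ m≡n)
  ... | no  m≢n = sym (when-no (degM m ℕ.≟ n) _ m≢n)

  lift⊗-at : ∀ (β : Series → Series → Series) (t : S⊗S) m →
             TensorOps.lift⊗ seriesVS seriesVS seriesVS β t m ≡ ∑⊗ t (λ g h → β g h m)
  lift⊗-at β []            m = ≡.refl
  lift⊗-at β ((g , h) ∷ t) m = ≡.cong (β g h m +_) (lift⊗-at β t m)

  module Antipode (S′ : Series → Series)
                  (S′-cong : ∀ f g → InSQSym f → InSQSym g → f ≈S g → S′ f ≈S S′ g)
                  (S′-+ : ∀ f g → InSQSym f → InSQSym g → S′ (f +S g) ≈S S′ f +S S′ g)
                  (S′-· : ∀ k f → InSQSym f → S′ (k ·S f) ≈S k ·S S′ f) where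

    S′-0S : S′ 0S ≈S 0S
    S′-0S m = trans (S′-cong 0S (0# ·S 0S) 0S-∈sQSym (·S-∈sQSym 0# 0S-∈sQSym) (λ _ → sym (zeroˡ 0#)) m)
                    (trans (S′-· 0# 0S 0S-∈sQSym m) (zeroˡ _))

    S′-sumS : ∀ {x} {X : Set x} (xs : List X) F → (∀ x → InSQSym (F x)) →
              S′ (sumS xs F) ≈S sumS xs (λ x → S′ (F x))
    S′-sumS []       F F∈ = S′-0S
    S′-sumS (x ∷ xs) F F∈ m =
      trans (S′-+ (F x) (sumS xs F) (F∈ x) (sumS-∈sQSym xs F F∈) m) (+-congˡ (S′-sumS xs F F∈ m))

    -- S′ is only known to be linear on sQSym, so μ ∘ (S′ ⊗ id) cannot be transported along ≈SS;
    -- instead both tensor factors are expanded in the M basis.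
    ∑⊗-S′*S-canonical : ∀ E t → InSQSym⊗≤ E t → ∀ m → ∑⊗ t (λ g h → (S′ g *S h) m)
                        ≈ ∑ (comps≤ E) (λ β → ∑ (comps≤ E) (λ γ → coefficient β γ t * (S′ (M β) *S M γ) m))
    ∑⊗-S′*S-canonical E [] [] m = sym (∑-zero (comps≤ E) (λ β → ∑-zero (comps≤ E) (λ γ → zeroˡ _)))
    ∑⊗-S′*S-canonical E ((f , g) ∷ t) (((f∈ , f≤) , g∈≤) ∷ t∈) m =
      trans (+-cong pure (∑⊗-S′*S-canonical E t t∈ m)) (sym (trans
        (∑-cong (comps≤ E) (λ β → trans (∑-cong (comps≤ E) (λ γ → distribʳ _ _ _)) (∑-distrib-+ (comps≤ E) _ _)))
        (∑-distrib-+ (comps≤ E) _ _)))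
      where
        pure : (S′ f *S g) m
             ≈ ∑ (comps≤ E) (λ β → ∑ (comps≤ E) (λ γ → (coeffM β f * coeffM γ g) * (S′ (M β) *S M γ) m))
        pure = begin
          (S′ f *S g) m
            ≈⟨ *S-cong (S′-cong f _ f∈ expansion-∈sQSym (M-expansion E f∈ f≤)) (M-expansion E (proj₁ g∈≤) (proj₂ g∈≤)) m ⟩
          (S′ (sumS (comps≤ E) (λ β → coeffM β f ·S M β)) *S sumS (comps≤ E) (λ γ → coeffM γ g ·S M γ)) m
            ≈⟨ *S-cong (S′-sumS (comps≤ E) _ (λ β → ·S-∈sQSym _ (M-∈sQSym β))) (λ _ → refl) m ⟩
          (sumS (comps≤ E) (λ β → S′ (coeffM β f ·S M β)) *S sumS (comps≤ E) (λ γ → coeffM γ g ·S M γ)) m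
            ≈⟨ *S-sumS (comps≤ E) (comps≤ E) _ _ m ⟩
          ∑ (comps≤ E) (λ β → ∑ (comps≤ E) (λ γ → (S′ (coeffM β f ·S M β) *S (coeffM γ g ·S M γ)) m))
            ≈⟨ ∑-cong (comps≤ E) (λ β → ∑-cong (comps≤ E) (λ γ → scalars β γ)) ⟩
          ∑ (comps≤ E) (λ β → ∑ (comps≤ E) (λ γ → (coeffM β f * coeffM γ g) * (S′ (M β) *S M γ) m)) ∎
          where
            expansion-∈sQSym = sumS-∈sQSym (comps≤ E) _ (λ β → ·S-∈sQSym _ (M-∈sQSym β))
            scalars : ∀ β γ → (S′ (coeffM β f ·S M β) *S (coeffM γ g ·S M γ)) m
                            ≈ (coeffM β f * coeffM γ g) * (S′ (M β) *S M γ) m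
            scalars β γ = begin
              (S′ (coeffM β f ·S M β) *S (coeffM γ g ·S M γ)) m
                ≈⟨ *S-cong (S′-· (coeffM β f) (M β) (M-∈sQSym β)) (λ _ → refl) m ⟩
              ((coeffM β f ·S S′ (M β)) *S (coeffM γ g ·S M γ)) m
                ≈⟨ trans (·S-*S _ _ _ m) (*-congˡ (*S-·S _ _ _ m)) ⟩
              coeffM β f * (coeffM γ g * (S′ (M β) *S M γ) m)
                ≈⟨ sym (*-assoc _ _ _) ⟩
              (coeffM β f * coeffM γ g) * (S′ (M β) *S M γ) m ∎

    ∑⊗-S′*S-resp : ∀ E {t u} → InSQSym⊗≤ E t → InSQSym⊗≤ E u → (∀ β γ → coefficient β γ t ≈ coefficient β γ u) →
                   ∀ m → ∑⊗ t (λ g h → (S′ g *S h) m) ≈ ∑⊗ u (λ g h → (S′ g *S h) m)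
    ∑⊗-S′*S-resp E {t} {u} t∈ u∈ t≈u m = trans (∑⊗-S′*S-canonical E t t∈ m)
      (trans (∑-cong (comps≤ E) (λ β → ∑-cong (comps≤ E) (λ γ → *-congʳ (t≈u β γ))))
             (sym (∑⊗-S′*S-canonical E u u∈ m)))

module Functionals {c ℓ a ℓa} (K : Field c ℓ) (A : Super.CombinatorialHopfSuperalgebra K a ℓa) where
  open Field K
  open Super K
  open Super.CombinatorialHopfSuperalgebra A
  open Sums commutativeRing
  open BilinearForms K
  open SQSym K using (sign; 1S-[]; 1S-absent∷; 1S-present∷)
  open import Algebra.Properties.CommutativeSemigroup *-commutativeSemigroup using (x∙yz≈y∙xz)
  open Compositions using (absent)
  open import Data.Vec using (Vec) renaming ([] to []ᵛ; _∷_ to _∷ᵛ_)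
  open import Relation.Binary.Reasoning.Setoid setoid
  open import Algebra.Properties.Ring ring using (-‿distribˡ-*; -‿distribʳ-*; -0#≈0#; -‿involutive)

  record IsLinear (f : Carrierᴹ → Carrier) : Set (a ⊔ ℓa ⊔ c ⊔ ℓ) where
    field
      lin-cong : ∀ {x y} → x ≈ᴹ y → f x ≈ f y
      lin-+    : ∀ x y → f (x +ᴹ y) ≈ f x + f y
      lin-·    : ∀ k x → f (k *ₗ x) ≈ k * f x

    lin-0 : f 0ᴹ ≈ 0#
    lin-0 = trans (lin-cong (≈ᴹ-sym (*ₗ-zeroˡ 0ᴹ))) (trans (lin-· 0# 0ᴹ) (zeroˡ _))

    lin-neg : ∀ x → f (-ᴹ x) ≈ - f x
    lin-neg x = begin
      f (-ᴹ x)                    ≈⟨ sym (+-identityˡ _) ⟩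
      0# + f (-ᴹ x)               ≈⟨ +-congʳ (sym (-‿inverseˡ (f x))) ⟩
      (- f x + f x) + f (-ᴹ x)    ≈⟨ +-assoc _ _ _ ⟩
      - f x + (f x + f (-ᴹ x))    ≈⟨ +-congˡ (sym (lin-+ x (-ᴹ x))) ⟩
      - f x + f (x +ᴹ -ᴹ x)       ≈⟨ +-congˡ (trans (lin-cong (-ᴹ‿inverseʳ x)) lin-0) ⟩
      - f x + 0#                  ≈⟨ +-identityʳ _ ⟩
      - f x                       ∎

    lin-sum : ∀ {y} {Y : Set y} (ys : List Y) (g : Y → Carrierᴹ) → f (sumV (map g ys)) ≈ ∑ ys (f ∘ g)
    lin-sum []       g = lin-0
    lin-sum (y ∷ ys) g = trans (lin-+ _ _) (+-congˡ (lin-sum ys g))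

  open IsLinear public

  record IsLinearMap (L : Carrierᴹ → Carrierᴹ) : Set (a ⊔ ℓa ⊔ c) where
    field
      map-cong : ∀ {x y} → x ≈ᴹ y → L x ≈ᴹ L y
      map-+    : ∀ x y → L (x +ᴹ y) ≈ᴹ L x +ᴹ L y
      map-·    : ∀ k x → L (k *ₗ x) ≈ᴹ k *ₗ L x

  linear-∘ : ∀ {f L} → IsLinear f → IsLinearMap L → IsLinear (f ∘ L)
  linear-∘ f-lin L-lin = record
    { lin-cong = λ x≈y → lin-cong f-lin (map-cong x≈y)
    ; lin-+    = λ x y → trans (lin-cong f-lin (map-+ x y)) (lin-+ f-lin _ _)
    ; lin-·    = λ k x → trans (lin-cong f-lin (map-· k x)) (lin-· f-lin _ _) }
    where open IsLinearMap L-lin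

  deg-linearMap : ∀ n → IsLinearMap (deg n)
  deg-linearMap n = record { map-cong = deg-cong n ; map-+ = deg-+ n ; map-· = deg-· n }

  S-linearMap : IsLinearMap S
  S-linearMap = record { map-cong = S-cong ; map-+ = S-+ ; map-· = S-· }

  ε-linear : IsLinear ε
  ε-linear = record { lin-cong = ε-cong ; lin-+ = ε-+ ; lin-· = ε-· }

  ⊗-bilinear : ∀ {f g} → IsLinear f → IsLinear g → Bilinear raw raw (λ x y → f x * g y)
  ⊗-bilinear f-lin g-lin = record
    { φ-cong  = λ x≈ y≈ → *-cong (lin-cong f-lin x≈) (lin-cong g-lin y≈)
    ; φ-+ˡ    = λ x x′ y → trans (*-congʳ (lin-+ f-lin x x′)) (distribʳ _ _ _)
    ; φ-+ʳ    = λ x y y′ → trans (*-congˡ (lin-+ g-lin y y′)) (distribˡ _ _ _)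
    ; φ-·     = λ k x y → trans (*-congʳ (lin-· f-lin k x))
                  (trans (*-assoc k _ _) (trans (x∙yz≈y∙xz k _ _) (*-congˡ (sym (lin-· g-lin k y)))))
    ; φ-zeroˡ = λ y → trans (*-congʳ (lin-0 f-lin)) (zeroˡ _) }

  infixl 7 _⊛_
  _⊛_ : (Carrierᴹ → Carrier) → (Carrierᴹ → Carrier) → Carrierᴹ → Carrier
  (f ⊛ g) x = ∑⊗ (Δ x) (λ a b → f a * g b)

  ∑⊗-·₂ : ∀ {f} (g : Carrierᴹ → Carrier) → IsLinear f → ∀ k (t : H⊗H) →
          ∑⊗ (k ·₂ t) (λ a b → f a * g b) ≈ k * ∑⊗ t (λ a b → f a * g b)
  ∑⊗-·₂ g f-lin k []            = sym (zeroʳ k)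
  ∑⊗-·₂ g f-lin k ((x , y) ∷ t) =
    trans (+-cong (trans (*-congʳ (lin-· f-lin k x)) (*-assoc _ _ _)) (∑⊗-·₂ g f-lin k t)) (sym (distribˡ _ _ _))

  ⊛-linear : ∀ {f g} → IsLinear f → IsLinear g → IsLinear (f ⊛ g)
  ⊛-linear {f} {g} f-lin g-lin = record
    { lin-cong = λ x≈y → ∑⊗-resp bilinear (Δ-cong x≈y)
    ; lin-+    = λ x y → trans (∑⊗-resp bilinear (Δ-+ x y)) (∑-++ (Δ x) (Δ y) _)
    ; lin-·    = λ k x → trans (∑⊗-resp bilinear (Δ-· k x)) (∑⊗-·₂ g f-lin k (Δ x)) }
    where bilinear = ⊗-bilinear f-lin g-lin

  ⊛-cong : ∀ {f f′ g g′} → (∀ x → f x ≈ f′ x) → (∀ x → g x ≈ g′ x) → ∀ x → (f ⊛ g) x ≈ (f′ ⊛ g′) x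
  ⊛-cong f≈f′ g≈g′ x = ∑-cong (Δ x) (λ p → *-cong (f≈f′ _) (g≈g′ _))

  ∑⊗-lift⊗ : ∀ {f} → IsLinear f → (β : Carrierᴹ → Carrierᴹ → Carrierᴹ) (t : H⊗H) →
             f (TensorOps.lift⊗ raw raw raw β t) ≈ ∑⊗ t (λ x y → f (β x y))
  ∑⊗-lift⊗ f-lin β []            = lin-0 f-lin
  ∑⊗-lift⊗ f-lin β ((x , y) ∷ t) = trans (lin-+ f-lin _ _) (+-congˡ (∑⊗-lift⊗ f-lin β t))

  ε-⊛ : ∀ {g} → IsLinear g → ∀ x → (ε ⊛ g) x ≈ g x
  ε-⊛ g-lin x = sym (trans (lin-cong g-lin (≈ᴹ-sym (counitˡ x)))
    (trans (∑⊗-lift⊗ g-lin (λ e y → ε e *ₗ y) (Δ x)) (∑-cong (Δ x) (λ p → lin-· g-lin _ _))))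

  ⊛-ε : ∀ {f} → IsLinear f → ∀ x → (f ⊛ ε) x ≈ f x
  ⊛-ε f-lin x = sym (trans (lin-cong f-lin (≈ᴹ-sym (counitʳ x))) (trans (∑⊗-lift⊗ f-lin (λ y e → ε e *ₗ y) (Δ x))
    (∑-cong (Δ x) (λ p → trans (lin-· f-lin _ _) (*-comm _ _)))))

  ⊛-assoc : ∀ {f g h} → IsLinear f → IsLinear g → IsLinear h → ∀ x → ((f ⊛ g) ⊛ h) x ≈ (f ⊛ (g ⊛ h)) x
  ⊛-assoc {f} {g} {h} f-lin g-lin h-lin x = begin
    ((f ⊛ g) ⊛ h) x
      ≈⟨ ∑-cong (Δ x) (λ p → trans (*-distribʳ-∑ _ (Δ (proj₁ p)) _)
           (∑-cong (Δ (proj₁ p)) (λ q → trans (*-assoc _ _ _) (*-congˡ (sym (+-identityʳ _)))))) ⟩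
    ∑⊗ (Δ x) (λ u d → ∑⊗ (Δ u) (λ a b → φ a [ (b , d) ]))
      ≈⟨ sym (∑⊗-⊗ᶠ Δ (λ z → z) (Δ x) _) ⟩
    ∑⊗ ((Δ ⊗ᶠ (λ z → z)) (Δ x)) (λ t d → ∑⊗ t (λ a b → φ a [ (b , d) ]))
      ≈⟨ sym (∑⊗-assoc⊗ ((Δ ⊗ᶠ (λ z → z)) (Δ x))) ⟩
    ∑⊗ (assoc⊗ ((Δ ⊗ᶠ (λ z → z)) (Δ x))) φ
      ≈⟨ ∑⊗-resp bilinear (Δ-coassoc x) ⟩
    ∑⊗ (((λ z → z) ⊗ᶠ Δ) (Δ x)) φ
      ≈⟨ ∑⊗-⊗ᶠ (λ z → z) Δ (Δ x) φ ⟩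
    (f ⊛ (g ⊛ h)) x ∎
    where
      φ : Carrierᴹ → H⊗H → Carrier
      φ a t = f a * ∑⊗ t (λ b d → g b * h d)
      ∑⊗-assoc⊗ : ∀ (T : List (H⊗H × Carrierᴹ)) →
                  ∑⊗ (assoc⊗ T) φ ≈ ∑⊗ T (λ t d → ∑⊗ t (λ a b → φ a [ (b , d) ]))
      ∑⊗-assoc⊗ []            = refl
      ∑⊗-assoc⊗ ((t , d) ∷ T) = trans (∑-++ (map _ t) (assoc⊗ T) _) (+-cong (∑-map _ t _) (∑⊗-assoc⊗ T))
      bilinear : Bilinear raw H⊗H-VS φ
      bilinear = record
        { φ-cong  = λ a≈ t≈ → *-cong (lin-cong f-lin a≈) (∑⊗-resp (⊗-bilinear g-lin h-lin) t≈)
        ; φ-+ˡ    = λ a a′ t → trans (*-congʳ (lin-+ f-lin a a′)) (distribʳ _ _ _)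
        ; φ-+ʳ    = λ a t t′ → trans (*-congˡ (∑-++ t t′ _)) (distribˡ _ _ _)
        ; φ-·     = λ k a t → trans (*-congʳ (lin-· f-lin k a))
                      (trans (*-assoc k _ _) (trans (x∙yz≈y∙xz k _ _) (*-congˡ (sym (∑⊗-·₂ h g-lin k t)))))
        ; φ-zeroˡ = λ t → trans (*-congʳ (lin-0 f-lin)) (zeroˡ _) }

  ∑⊗-when : ∀ {p q} {P : Set p} {Q : Set q} (d₁ : Dec P) (d₂ : Dec Q) (t : H⊗H) (f g : Carrierᴹ → Carrier) →
            ∑⊗ t (λ x y → when d₁ (f x) * when d₂ (g y)) ≈ when d₁ (when d₂ (∑⊗ t (λ x y → f x * g y)))
  ∑⊗-when d₁ d₂ t f g = trans (∑-cong t (λ p → when-* d₁ d₂ _ _))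
    (trans (∑-when d₁ t _) (when-cong d₁ (∑-when d₂ t _)))

  Homogeneous : ℕ → (Carrierᴹ → Carrier) → Set (a ⊔ ℓ)
  Homogeneous d f = ∀ n x → f (deg n x) ≈ when (d ℕ.≟ n) (f x)

  linear-components : ∀ {f} → IsLinear f → ∀ N x → x ≈ᴹ sumV (map (λ n → deg n x) (upTo N)) →
                      f x ≈ ∑< N (λ n → f (deg n x))
  linear-components f-lin N x x≈ =
    trans (lin-cong f-lin x≈) (trans (lin-sum f-lin (upTo N) (λ n → deg n x)) (∑-upTo N _))

  linear-expand : ∀ {f} → IsLinear f → ∀ x →
                  ∃ λ N → (∀ n → N ≤ n → deg n x ≈ᴹ 0ᴹ) × (f x ≈ ∑< N (λ n → f (deg n x)))
  linear-expand f-lin x with deg-fin x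
  ... | N , vanish , x≈ = N , vanish , linear-components f-lin N x x≈

  linear-concentrated : ∀ {f} → IsLinear f → ∀ n₀ → (∀ n x → n ≢ n₀ → f (deg n x) ≈ 0#) →
                        ∀ x → f x ≈ f (deg n₀ x)
  linear-concentrated f-lin n₀ off≈0 x with linear-expand f-lin x
  ... | N , vanish , fx≈ with n₀ <? N
  ...   | yes n₀<N = trans fx≈
    (trans (∑<-delta N _ n₀ (λ n _ n≢n₀ → off≈0 n x n≢n₀)) (when-yes (n₀ <? N) _ n₀<N))
  ...   | no  n₀≮N = trans fx≈
    (trans (∑<-zero N (λ n n<N → off≈0 n x (λ n≡n₀ → n₀≮N (≡.subst (_< N) n≡n₀ n<N))))
           (sym (trans (lin-cong f-lin (vanish n₀ (ℕ.≮⇒≥ n₀≮N))) (lin-0 f-lin))))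

  ε-homogeneous : Homogeneous 0 ε
  ε-homogeneous zero    x = sym (linear-concentrated ε-linear 0 off≈0 x)
    where off≈0 : ∀ n x → n ≢ 0 → ε (deg n x) ≈ 0#
          off≈0 zero    x 0≢0 = ⊥-elim (0≢0 ≡.refl)
          off≈0 (suc n) x _   = deg-ε n x
  ε-homogeneous (suc n) x = deg-ε n x

  deg-homogeneous : ∀ {f} → IsLinear f → ∀ d → Homogeneous d (f ∘ deg d)
  deg-homogeneous f-lin d n x with d ℕ.≟ n
  ... | yes ≡.refl = trans (lin-cong f-lin (deg-idem d x)) (sym (when-yes (d ℕ.≟ d) _ ≡.refl))
  ... | no  d≢n    =
    trans (lin-cong f-lin (deg-orth d n x d≢n)) (trans (lin-0 f-lin) (sym (when-no (d ℕ.≟ n) _ d≢n)))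

  ⊛-homogeneous : ∀ {f g d d′} → IsLinear f → IsLinear g → Homogeneous d f → Homogeneous d′ g →
                  Homogeneous (d ℕ.+ d′) (f ⊛ g)
  ⊛-homogeneous {f} {g} {d} {d′} f-lin g-lin f-hom g-hom n x = begin
    (f ⊛ g) (deg n x)
      ≈⟨ ∑⊗-resp (⊗-bilinear f-lin g-lin) (deg-Δ n x) ⟩
    ∑⊗ (concatMap (λ i → (deg i ⊗ᶠ deg (n ∸ i)) (Δ x)) (upTo (suc n))) (λ a b → f a * g b)
      ≈⟨ ∑-concatMap (λ i → (deg i ⊗ᶠ deg (n ∸ i)) (Δ x)) (upTo (suc n)) _ ⟩
    ∑ (upTo (suc n)) (λ i → ∑⊗ ((deg i ⊗ᶠ deg (n ∸ i)) (Δ x)) (λ a b → f a * g b))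
      ≈⟨ ∑-cong (upTo (suc n)) (λ i → trans (∑⊗-⊗ᶠ (deg i) (deg (n ∸ i)) (Δ x) _)
           (trans (∑-cong (Δ x) (λ p → *-cong (f-hom i _) (g-hom (n ∸ i) _)))
                  (∑⊗-when (d ℕ.≟ i) (d′ ℕ.≟ n ∸ i) (Δ x) f g))) ⟩
    ∑ (upTo (suc n)) (λ i → when (d ℕ.≟ i) (when (d′ ℕ.≟ n ∸ i) ((f ⊛ g) x)))
      ≈⟨ ∑-upTo (suc n) _ ⟩
    ∑< (suc n) (λ i → when (d ℕ.≟ i) (when (d′ ℕ.≟ n ∸ i) ((f ⊛ g) x)))
      ≈⟨ ∑<-delta (suc n) _ d (λ i _ i≢d → when-no (d ℕ.≟ i) (when (d′ ℕ.≟ n ∸ i) ((f ⊛ g) x)) (i≢d ∘ ≡.sym)) ⟩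
    when (d <? suc n) (when (d ℕ.≟ d) (when (d′ ℕ.≟ n ∸ d) ((f ⊛ g) x)))
      ≈⟨ when-cong (d <? suc n) (when-yes (d ℕ.≟ d) (when (d′ ℕ.≟ n ∸ d) ((f ⊛ g) x)) ≡.refl) ⟩
    when (d <? suc n) (when (d′ ℕ.≟ n ∸ d) ((f ⊛ g) x))
      ≈⟨ when-when (d <? suc n) (d′ ℕ.≟ n ∸ d) (d ℕ.+ d′ ℕ.≟ n) _
           (λ { (s≤s d≤n) d′≡ → ≡.trans (≡.cong (d ℕ.+_) d′≡) (ℕ.m+[n∸m]≡n d≤n) })
           (λ d+d′≡n → s≤s (≡.subst (d ≤_) d+d′≡n (ℕ.m≤m+n d d′)))
           (λ d+d′≡n → ≡.trans (≡.sym (ℕ.m+n∸m≡n d d′)) (≡.cong (_∸ d) d+d′≡n)) ⟩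
    when (d ℕ.+ d′ ℕ.≟ n) ((f ⊛ g) x) ∎

  HasParity : Parity → (Carrierᴹ → Carrier) → Set (a ⊔ ℓ)
  HasParity p f = ∀ q x → f (par q x) ≈ when (p ≟P q) (f x)

  even-hasParity : ∀ {f} → IsLinear f → (∀ x → f (par odd x) ≈ 0#) → HasParity even f
  even-hasParity f-lin odd≈0 even x = sym (trans (lin-cong f-lin (par-sum x))
    (trans (lin-+ f-lin _ _) (trans (+-congˡ (odd≈0 x)) (+-identityʳ _))))
  even-hasParity f-lin odd≈0 odd  x = odd≈0 x

  odd-hasParity : ∀ {f} → IsLinear f → (∀ x → f (par even x) ≈ 0#) → HasParity odd f
  odd-hasParity f-lin even≈0 even x = even≈0 x
  odd-hasParity f-lin even≈0 odd  x = sym (trans (lin-cong f-lin (par-sum x))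
    (trans (lin-+ f-lin _ _) (trans (+-congʳ (even≈0 x)) (+-identityˡ _))))

  ε-hasParity : HasParity even ε
  ε-hasParity = even-hasParity ε-linear ε-even

  deg-hasParity : ∀ {f p} → IsLinear f → HasParity p f → ∀ n → HasParity p (f ∘ deg n)
  deg-hasParity f-lin f-par n q x = trans (lin-cong f-lin (≈ᴹ-sym (deg-par n q x))) (f-par q _)

  ⊛-hasParity : ∀ {f g p p′} → IsLinear f → IsLinear g → HasParity p f → HasParity p′ g →
                HasParity (p ⊕ p′) (f ⊛ g)
  ⊛-hasParity {f} {g} {p} {p′} f-lin g-lin f-par g-par r x = begin
    (f ⊛ g) (par r x)
      ≈⟨ ∑⊗-resp (⊗-bilinear f-lin g-lin) (Δ-even r x) ⟩
    ∑⊗ ((par even ⊗ᶠ par r) (Δ x) ++ (par odd ⊗ᶠ par (odd ⊕ r)) (Δ x)) (λ a b → f a * g b)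
      ≈⟨ ∑-++ ((par even ⊗ᶠ par r) (Δ x)) _ _ ⟩
    ∑⊗ ((par even ⊗ᶠ par r) (Δ x)) (λ a b → f a * g b) + ∑⊗ ((par odd ⊗ᶠ par (odd ⊕ r)) (Δ x)) (λ a b → f a * g b)
      ≈⟨ +-cong (block even r) (block odd (odd ⊕ r)) ⟩
    when (p ≟P even) (when (p′ ≟P r) ((f ⊛ g) x)) + when (p ≟P odd) (when (p′ ≟P (odd ⊕ r)) ((f ⊛ g) x))
      ≈⟨ combine p p′ r ⟩
    when ((p ⊕ p′) ≟P r) ((f ⊛ g) x) ∎
    where
      block : ∀ q q′ → ∑⊗ ((par q ⊗ᶠ par q′) (Δ x)) (λ a b → f a * g b) ≈ when (p ≟P q) (when (p′ ≟P q′) ((f ⊛ g) x))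
      block q q′ = trans (∑⊗-⊗ᶠ (par q) (par q′) (Δ x) _)
        (trans (∑-cong (Δ x) (λ _ → *-cong (f-par q _) (g-par q′ _))) (∑⊗-when (p ≟P q) (p′ ≟P q′) (Δ x) f g))
      combine : ∀ p p′ r {v} → when (p ≟P even) (when (p′ ≟P r) v) + when (p ≟P odd) (when (p′ ≟P (odd ⊕ r)) v)
                                 ≈ when ((p ⊕ p′) ≟P r) v
      combine even even even = +-identityʳ _
      combine even even odd  = +-identityʳ _
      combine even odd  even = +-identityʳ _
      combine even odd  odd  = +-identityʳ _
      combine odd  even even = +-identityˡ _
      combine odd  even odd  = +-identityˡ _
      combine odd  odd  even = +-identityˡ _
      combine odd  odd  odd  = +-identityˡ _

  component : Bool → 𝕜[ε] → Carrier
  component false = proj₁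
  component true  = proj₂

  component-cong : ∀ b {u v} → u ≈ε v → component b u ≈ component b v
  component-cong false = proj₁
  component-cong true  = proj₂

  ζᵇ : Bool → Carrierᴹ → Carrier
  ζᵇ b x = component b (ζ x)

  ζᵇ-linear : ∀ b → IsLinear (ζᵇ b)
  ζᵇ-linear false = record
    { lin-cong = λ x≈y → proj₁ (ζ-cong x≈y) ; lin-+ = λ x y → proj₁ (ζ-+ x y) ; lin-· = λ k x → proj₁ (ζ-· k x) }
  ζᵇ-linear true  = record
    { lin-cong = λ x≈y → proj₂ (ζ-cong x≈y) ; lin-+ = λ x y → proj₂ (ζ-+ x y) ; lin-· = λ k x → proj₂ (ζ-· k x) }

  parityᵇ : Bool → Parity
  parityᵇ false = even
  parityᵇ true  = odd

  ζᵇ-hasParity : ∀ b → HasParity (parityᵇ b) (ζᵇ b)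
  ζᵇ-hasParity false = even-hasParity (ζᵇ-linear false) ζ-even₁
  ζᵇ-hasParity true  = odd-hasParity (ζᵇ-linear true) ζ-even₀

  degree-zero : ∀ {f} → IsLinear f → ∀ x → f (deg 0 x) ≈ ε x * f 1H
  degree-zero {f} f-lin x with connected x
  ... | k , deg₀x≈ = begin
    f (deg 0 x)   ≈⟨ lin-cong f-lin deg₀x≈ ⟩
    f (k *ₗ 1H)   ≈⟨ lin-· f-lin k 1H ⟩
    k * f 1H      ≈⟨ *-congʳ k≈εx ⟩
    ε x * f 1H    ∎
    where
      k≈εx : k ≈ ε x
      k≈εx = begin
        k               ≈⟨ sym (trans (*-congˡ ε-1) (*-identityʳ k)) ⟩
        k * ε 1H        ≈⟨ sym (lin-· ε-linear k 1H) ⟩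
        ε (k *ₗ 1H)     ≈⟨ sym (lin-cong ε-linear deg₀x≈) ⟩
        ε (deg 0 x)     ≈⟨ ε-homogeneous 0 x ⟩
        ε x             ∎

  entryDegree : ℕ × Bool → ℕ
  entryDegree (e , false) = e
  entryDegree (e , true)  = suc e

  degM-single : ∀ h → degM [ h ] ≡ entryDegree h
  degM-single (e , false) = ≡.trans (ℕ.+-identityʳ _) (ℕ.+-identityʳ e)
  degM-single (e , true)  = ≡.trans (ℕ.+-identityʳ _) (ℕ.+-comm e 1)

  -- The coefficient of x₁^e (b = false) or θ₁x₁^e (b = true) in Ψ x; θ₁ has degree 1.
  ζᵉ : ℕ × Bool → Carrierᴹ → Carrier
  ζᵉ h = ζᵇ (proj₂ h) ∘ deg (entryDegree h)

  ζᵉ-linear : ∀ h → IsLinear (ζᵉ h)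
  ζᵉ-linear h = linear-∘ (ζᵇ-linear (proj₂ h)) (deg-linearMap (entryDegree h))

  ζᵉ-homogeneous : ∀ h → Homogeneous (entryDegree h) (ζᵉ h)
  ζᵉ-homogeneous h = deg-homogeneous (ζᵇ-linear (proj₂ h)) (entryDegree h)

  ζᵉ-hasParity : ∀ h → HasParity (parityᵇ (proj₂ h)) (ζᵉ h)
  ζᵉ-hasParity h =
    deg-hasParity {p = parityᵇ (proj₂ h)} (ζᵇ-linear (proj₂ h)) (ζᵇ-hasParity (proj₂ h)) (entryDegree h)

  ζᵉ-absent : ∀ x → ζᵉ (0 , false) x ≈ ε x
  ζᵉ-absent x = trans (degree-zero (ζᵇ-linear false) x) (trans (*-congˡ (proj₁ ζ-1)) (*-identityʳ _))

  ζ-odd-degree-zero : ∀ x → ζᵇ true (deg 0 x) ≈ 0#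
  ζ-odd-degree-zero x = trans (degree-zero (ζᵇ-linear true) x) (trans (*-congˡ (proj₂ ζ-1)) (zeroʳ _))

  ζᵐ : Monomial → Carrierᴹ → Carrier
  ζᵐ []      = ε
  ζᵐ (h ∷ m) = ζᵉ h ⊛ ζᵐ m

  ζᵐ-linear : ∀ m → IsLinear (ζᵐ m)
  ζᵐ-linear []      = ε-linear
  ζᵐ-linear (h ∷ m) = ⊛-linear (ζᵉ-linear h) (ζᵐ-linear m)

  degM-∷ : ∀ h m → entryDegree h ℕ.+ degM m ≡ degM (h ∷ m)
  degM-∷ (e , false) m = ≡.cong (ℕ._+ degM m) (≡.sym (ℕ.+-identityʳ e))
  degM-∷ (e , true)  m = ≡.cong (ℕ._+ degM m) (ℕ.+-comm 1 e)

  ζᵐ-homogeneous : ∀ m → Homogeneous (degM m) (ζᵐ m)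
  ζᵐ-homogeneous []      = ε-homogeneous
  ζᵐ-homogeneous (h ∷ m) = ≡.subst (λ d → Homogeneous d (ζᵐ (h ∷ m))) (degM-∷ h m)
    (⊛-homogeneous {d = entryDegree h} (ζᵉ-linear h) (ζᵐ-linear m) (ζᵉ-homogeneous h) (ζᵐ-homogeneous m))

  ζᵐ-hasParity : ∀ m → HasParity (parM m) (ζᵐ m)
  ζᵐ-hasParity []                = ε-hasParity
  ζᵐ-hasParity ((e , false) ∷ m) =
    ⊛-hasParity {p = even} {p′ = parM m} (ζᵉ-linear (e , false)) (ζᵐ-linear m) (ζᵉ-hasParity (e , false)) (ζᵐ-hasParity m)
  ζᵐ-hasParity ((e , true) ∷ m)  =
    ⊛-hasParity {p = odd} {p′ = parM m} (ζᵉ-linear (e , true)) (ζᵐ-linear m) (ζᵉ-hasParity (e , true)) (ζᵐ-hasParity m)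

  ζᵐ-++ : ∀ m₁ m₂ x → ζᵐ (m₁ ++ m₂) x ≈ (ζᵐ m₁ ⊛ ζᵐ m₂) x
  ζᵐ-++ []       m₂ x = sym (ε-⊛ (ζᵐ-linear m₂) x)
  ζᵐ-++ (h ∷ m₁) m₂ x = begin
    (ζᵉ h ⊛ ζᵐ (m₁ ++ m₂)) x            ≈⟨ ⊛-cong (λ _ → refl) (ζᵐ-++ m₁ m₂) x ⟩
    (ζᵉ h ⊛ (ζᵐ m₁ ⊛ ζᵐ m₂)) x          ≈⟨ sym (⊛-assoc (ζᵉ-linear h) (ζᵐ-linear m₁) (ζᵐ-linear m₂) x) ⟩
    (ζᵉ h ⊛ ζᵐ m₁ ⊛ ζᵐ m₂) x            ∎

  linear-deg-∙ : ∀ {f} → IsLinear f → ∀ n x y → f (deg n (x ∙ y)) ≈ ∑< (suc n) (λ i → f (deg i x ∙ deg (n ∸ i) y))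
  linear-deg-∙ f-lin n x y =
    trans (lin-cong f-lin (deg-∙ n x y)) (trans (lin-sum f-lin (upTo (suc n)) _) (∑-upTo (suc n) _))

  record ProductRule (F : Carrierᴹ → Carrier) : Set (lsuc 0ℓ ⊔ a ⊔ c ⊔ ℓ) where
    field
      Index        : Set
      terms        : List Index
      coeff        : Index → Carrier
      left right   : Index → Carrierᴹ → Carrier
      leftParity   : Index → Parity
      rightParity  : Index → Parity
      left-parity  : ∀ i → HasParity (leftParity i) (left i)
      right-parity : ∀ i → HasParity (rightParity i) (right i)
      rule         : ∀ x y → F (x ∙ y) ≈ ∑ terms (λ i → coeff i * (left i x * right i y))

  koszul : Parity → Parity → Carrier
  koszul odd  odd  = - 1#
  koszul odd  even = 1#
  koszul even q    = 1#

  private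
    rearrange : ∀ f g u v w z → (g * (u * w)) * (f * (v * z)) ≈ (f * g) * ((u * v) * (w * z))
    rearrange = solve 6 (λ f g u v w z → (g ⊙ (u ⊙ w)) ⊙ (f ⊙ (v ⊙ z)) ⊜ (f ⊙ g) ⊙ ((u ⊙ v) ⊙ (w ⊙ z))) refl
      where open import Algebra.Solver.CommutativeMonoid *-commutativeMonoid
              using (solve; _⊜_) renaming (_⊕_ to _⊙_)

    rearrange₁ : ∀ f g u v w z → (g * (u * w)) * (f * (v * z)) ≈ (f * (g * 1#)) * ((u * v) * (w * z))
    rearrange₁ f g u v w z = trans (rearrange f g u v w z) (*-congʳ (*-congˡ (sym (*-identityʳ g))))

    rearrange₋₁ : ∀ f g u v w z → - ((g * (u * w)) * (f * (v * z))) ≈ (f * (g * - 1#)) * ((u * v) * (w * z))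
    rearrange₋₁ f g u v w z = trans (-‿cong (rearrange f g u v w z)) (trans (-‿distribˡ-* _ _)
      (*-congʳ (trans (-‿distribʳ-* f g) (*-congˡ (trans (sym (*-identityʳ (- g)))
        (trans (sym (-‿distribˡ-* g 1#)) (-‿distribʳ-* g 1#)))))))

    killˡ : ∀ g u y → (g * (u * 0#)) * y ≈ 0#
    killˡ g u y = trans (*-congʳ (trans (*-congˡ (zeroʳ u)) (zeroʳ g))) (zeroˡ y)

    killʳ : ∀ x f z → x * (f * (0# * z)) ≈ 0#
    killʳ x f z = trans (*-congˡ (trans (*-congˡ (zeroˡ z)) (zeroʳ f))) (zeroʳ x)

  ∑⊗-⋆ : ∀ (t u : H⊗H) (ψ : Carrierᴹ → Carrierᴹ → Carrier) →
         ∑⊗ (t ⋆ u) ψ ≈ ∑⊗ t (λ a b → ∑⊗ u (λ c d → ψ (a ∙ par even c) (b ∙ d)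
                                        + (ψ (a ∙ par odd c) (par even b ∙ d)
                                        + (ψ (a ∙ par odd c) (-ᴹ (par odd b ∙ d)) + 0#))))
  ∑⊗-⋆ t u ψ = trans (∑-concatMap _ t _) (∑-cong t (λ p → ∑-concatMap _ u _))

  -- The three summands of (a ⊗ b)(c ⊗ d) in _⋆_ combine to the sign (-1)^{|b||c|}, for P = |c| and Q = |b|.
  koszul-sum : ∀ P Q g f u v w z →
      (g * (u * when (P ≟P even) w)) * (f * (v * z))
    + ((g * (u * when (P ≟P odd) w)) * (f * (when (Q ≟P even) v * z))
    + (- ((g * (u * when (P ≟P odd) w)) * (f * (when (Q ≟P odd) v * z))) + 0#))
    ≈ (f * (g * koszul P Q)) * ((u * v) * (w * z))
  koszul-sum even Q    g f u v w z = trans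
    (+-congˡ (trans (+-cong (killˡ g u _) (trans (+-congʳ (trans (-‿cong (killˡ g u _)) -0#≈0#)) (+-identityˡ _)))
                    (+-identityˡ _)))
    (trans (+-identityʳ _) (rearrange₁ f g u v w z))
  koszul-sum odd  even g f u v w z = trans
    (+-cong (killˡ g u _) (+-congˡ (trans (+-congʳ (trans (-‿cong (killʳ _ f z)) -0#≈0#)) (+-identityˡ _))))
    (trans (+-identityˡ _) (trans (+-identityʳ _) (rearrange₁ f g u v w z)))
  koszul-sum odd  odd  g f u v w z = trans (+-cong (killˡ g u _) (+-cong (killʳ _ f z) (+-identityʳ _)))
    (trans (+-identityˡ _) (trans (+-identityˡ _) (rearrange₋₁ f g u v w z)))

  module _ {G F} (G-lin : IsLinear G) (F-lin : IsLinear F) (ruleG : ProductRule G) (ruleF : ProductRule F) where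
    private
      module RG = ProductRule ruleG
      module RF = ProductRule ruleF

    ⊛-coeff : RG.Index → RF.Index → Carrier
    ⊛-coeff i j = RF.coeff j * (RG.coeff i * koszul (RG.rightParity i) (RF.leftParity j))

    ⊛-∙-summand : ∀ a b c d →
        G (a ∙ par even c) * F (b ∙ d)
      + (G (a ∙ par odd c) * F (par even b ∙ d) + (G (a ∙ par odd c) * F (-ᴹ (par odd b ∙ d)) + 0#))
      ≈ ∑ RF.terms (λ j → ∑ RG.terms (λ i → ⊛-coeff i j * ((RG.left i a * RF.left j b) * (RG.right i c * RF.right j d))))
    ⊛-∙-summand a b c d = begin
        G (a ∙ par even c) * F (b ∙ d)
          + (G (a ∙ par odd c) * F (par even b ∙ d) + (G (a ∙ par odd c) * F (-ᴹ (par odd b ∙ d)) + 0#))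
      ≈⟨ +-cong (*-cong (G-par even) (RF.rule b d)) (+-cong (*-cong (G-par odd) (F-par even))
           (+-congʳ (*-cong (G-par odd) (trans (lin-neg F-lin _) (-‿cong (F-par odd)))))) ⟩
        ∑G even * ∑F (λ j → RF.left j b) + (∑G odd * ∑F (λ j → when (RF.leftParity j ≟P even) (RF.left j b))
          + (∑G odd * (- ∑F (λ j → when (RF.leftParity j ≟P odd) (RF.left j b))) + 0#))
      ≈⟨ +-cong (product _ _) (+-cong (product _ _) (+-congʳ (trans (sym (-‿distribʳ-* _ _))
           (trans (-‿cong (product _ _))
                  (trans (-‿distrib-∑ RF.terms _) (∑-cong RF.terms (λ j → -‿distrib-∑ RG.terms _))))))) ⟩
        ∑ RF.terms (λ j → ∑ RG.terms (λ i → T₁ i j)) + (∑ RF.terms (λ j → ∑ RG.terms (λ i → T₂ i j))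
          + (∑ RF.terms (λ j → ∑ RG.terms (λ i → - T₃ i j)) + 0#))
      ≈⟨ sym (trans (∑-cong RF.terms (λ j → distrib₃ RG.terms (T₁ ⟨ j ⟩) (T₂ ⟨ j ⟩) (λ i → - T₃ i j)))
                    (distrib₃ RF.terms _ _ _)) ⟩
        ∑ RF.terms (λ j → ∑ RG.terms (λ i → T₁ i j + (T₂ i j + (- T₃ i j + 0#))))
      ≈⟨ ∑-cong RF.terms (λ j → ∑-cong RG.terms (λ i → koszul-sum (RG.rightParity i) (RF.leftParity j)
           (RG.coeff i) (RF.coeff j) (RG.left i a) (RF.left j b) (RG.right i c) (RF.right j d))) ⟩
        ∑ RF.terms (λ j → ∑ RG.terms (λ i → ⊛-coeff i j * ((RG.left i a * RF.left j b) * (RG.right i c * RF.right j d)))) ∎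
      where
        ∑G : Parity → Carrier
        ∑G r = ∑ RG.terms (λ i → RG.coeff i * (RG.left i a * when (RG.rightParity i ≟P r) (RG.right i c)))
        ∑F : (RF.Index → Carrier) → Carrier
        ∑F h = ∑ RF.terms (λ j → RF.coeff j * (h j * RF.right j d))
        G-par : ∀ r → G (a ∙ par r c) ≈ ∑G r
        G-par r = trans (RG.rule a (par r c)) (∑-cong RG.terms (λ i → *-congˡ (*-congˡ (RG.right-parity i r c))))
        F-par : ∀ r → F (par r b ∙ d) ≈ ∑F (λ j → when (RF.leftParity j ≟P r) (RF.left j b))
        F-par r = trans (RF.rule (par r b) d) (∑-cong RF.terms (λ j → *-congˡ (*-congʳ (RF.left-parity j r b))))
        product : ∀ (gᵢ : RG.Index → Carrier) (fⱼ : RF.Index → Carrier) →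
                  ∑ RG.terms gᵢ * ∑ RF.terms fⱼ ≈ ∑ RF.terms (λ j → ∑ RG.terms (λ i → gᵢ i * fⱼ j))
        product gᵢ fⱼ = trans (∑-*-∑ RG.terms RF.terms gᵢ fⱼ) (∑-comm RG.terms RF.terms _)
        T₁ T₂ T₃ : RG.Index → RF.Index → Carrier
        T₁ i j = (RG.coeff i * (RG.left i a * when (RG.rightParity i ≟P even) (RG.right i c)))
                 * (RF.coeff j * (RF.left j b * RF.right j d))
        T₂ i j = (RG.coeff i * (RG.left i a * when (RG.rightParity i ≟P odd) (RG.right i c)))
                 * (RF.coeff j * (when (RF.leftParity j ≟P even) (RF.left j b) * RF.right j d))
        T₃ i j = (RG.coeff i * (RG.left i a * when (RG.rightParity i ≟P odd) (RG.right i c)))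
                 * (RF.coeff j * (when (RF.leftParity j ≟P odd) (RF.left j b) * RF.right j d))
        _⟨_⟩ : (RG.Index → RF.Index → Carrier) → RF.Index → RG.Index → Carrier
        (T ⟨ j ⟩) i = T i j
        distrib₃ : ∀ {X : Set} (xs : List X) u v w →
                   ∑ xs (λ x → u x + (v x + (w x + 0#))) ≈ ∑ xs u + (∑ xs v + (∑ xs w + 0#))
        distrib₃ xs u v w = trans (∑-distrib-+ xs _ _) (+-congˡ (trans (∑-distrib-+ xs _ _)
          (+-congˡ (trans (∑-distrib-+ xs _ _) (+-congˡ (∑-zero xs (λ _ → refl)))))))

    ⊛-∙ : ∀ x y → (G ⊛ F) (x ∙ y) ≈
          ∑ RF.terms (λ j → ∑ RG.terms (λ i → ⊛-coeff i j * ((RG.left i ⊛ RF.left j) x * (RG.right i ⊛ RF.right j) y)))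
    ⊛-∙ x y = begin
        (G ⊛ F) (x ∙ y)
      ≈⟨ ∑⊗-resp (⊗-bilinear G-lin F-lin) (Δ-∙ x y) ⟩
        ∑⊗ (Δ x ⋆ Δ y) (λ a b → G a * F b)
      ≈⟨ ∑⊗-⋆ (Δ x) (Δ y) _ ⟩
        ∑ (Δ x) (λ p → ∑ (Δ y) (λ q → _))
      ≈⟨ ∑-cong (Δ x) (λ p → ∑-cong (Δ y) (λ q → ⊛-∙-summand (proj₁ p) (proj₂ p) (proj₁ q) (proj₂ q))) ⟩
        ∑ (Δ x) (λ p → ∑ (Δ y) (λ q → ∑ RF.terms (λ j → ∑ RG.terms (λ i → H i j p q))))
      ≈⟨ interchange ⟩
        ∑ RF.terms (λ j → ∑ RG.terms (λ i → ∑ (Δ x) (λ p → ∑ (Δ y) (λ q → H i j p q))))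
      ≈⟨ ∑-cong RF.terms (λ j → ∑-cong RG.terms (λ i → sym (trans (*-congˡ (∑-*-∑ (Δ x) (Δ y) _ _))
           (trans (*-distribˡ-∑ _ (Δ x) _) (∑-cong (Δ x) (λ p → *-distribˡ-∑ _ (Δ y) _)))))) ⟩
        ∑ RF.terms (λ j → ∑ RG.terms (λ i → ⊛-coeff i j * ((RG.left i ⊛ RF.left j) x * (RG.right i ⊛ RF.right j) y))) ∎
      where
        H : RG.Index → RF.Index → Carrierᴹ × Carrierᴹ → Carrierᴹ × Carrierᴹ → Carrier
        H i j p q = ⊛-coeff i j
                    * ((RG.left i (proj₁ p) * RF.left j (proj₂ p)) * (RG.right i (proj₁ q) * RF.right j (proj₂ q)))
        interchange : ∑ (Δ x) (λ p → ∑ (Δ y) (λ q → ∑ RF.terms (λ j → ∑ RG.terms (λ i → H i j p q))))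
                    ≈ ∑ RF.terms (λ j → ∑ RG.terms (λ i → ∑ (Δ x) (λ p → ∑ (Δ y) (λ q → H i j p q))))
        interchange = begin
          ∑ (Δ x) (λ p → ∑ (Δ y) (λ q → ∑ RF.terms (λ j → ∑ RG.terms (λ i → H i j p q))))
            ≈⟨ ∑-cong (Δ x) (λ p → ∑-comm (Δ y) RF.terms _) ⟩
          ∑ (Δ x) (λ p → ∑ RF.terms (λ j → ∑ (Δ y) (λ q → ∑ RG.terms (λ i → H i j p q))))
            ≈⟨ ∑-comm (Δ x) RF.terms _ ⟩
          ∑ RF.terms (λ j → ∑ (Δ x) (λ p → ∑ (Δ y) (λ q → ∑ RG.terms (λ i → H i j p q))))
            ≈⟨ ∑-cong RF.terms (λ j → ∑-cong (Δ x) (λ p → ∑-comm (Δ y) RG.terms _)) ⟩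
          ∑ RF.terms (λ j → ∑ (Δ x) (λ p → ∑ RG.terms (λ i → ∑ (Δ y) (λ q → H i j p q))))
            ≈⟨ ∑-cong RF.terms (λ j → ∑-comm (Δ x) RG.terms _) ⟩
          ∑ RF.terms (λ j → ∑ RG.terms (λ i → ∑ (Δ x) (λ p → ∑ (Δ y) (λ q → H i j p q)))) ∎

  entrySplits : ℕ × Bool → List (ℕ × Bool)
  entrySplits (e , false) = map (λ i → (i , false)) (upTo (suc e))
  entrySplits (e , true)  = map (λ i → (i , true)) (upTo (suc e)) ++ map (λ i → (i , false)) (upTo (suc e))

  complement : ℕ × Bool → ℕ × Bool → ℕ × Bool
  complement (e , b) (i , b′) = (e ∸ i , b xor b′)

  ζᵉ-∙ : ∀ h x y → ζᵉ h (x ∙ y) ≈ ∑ (entrySplits h) (λ i → 1# * (ζᵉ i x * ζᵉ (complement h i) y))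
  ζᵉ-∙ (e , false) x y = begin
    ζᵇ false (deg e (x ∙ y))
      ≈⟨ linear-deg-∙ (ζᵇ-linear false) e x y ⟩
    ∑< (suc e) (λ i → ζᵇ false (deg i x ∙ deg (e ∸ i) y))
      ≈⟨ ∑<-cong (suc e) (λ i _ → trans (proj₁ (ζ-∙ (deg i x) (deg (e ∸ i) y))) (sym (*-identityˡ _))) ⟩
    ∑< (suc e) (λ i → 1# * (ζᵉ (i , false) x * ζᵉ (e ∸ i , false) y))
      ≈⟨ sym (trans (∑-map _ (upTo (suc e)) _) (∑-upTo (suc e) _)) ⟩
    ∑ (entrySplits (e , false)) (λ i → 1# * (ζᵉ i x * ζᵉ (complement (e , false) i) y)) ∎
  ζᵉ-∙ (e , true) x y = begin
    ζᵇ true (deg (suc e) (x ∙ y))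
      ≈⟨ linear-deg-∙ (ζᵇ-linear true) (suc e) x y ⟩
    ∑< (suc (suc e)) (λ i → ζᵇ true (deg i x ∙ deg (suc e ∸ i) y))
      ≈⟨ ∑<-cong (suc (suc e)) (λ i _ → proj₂ (ζ-∙ (deg i x) (deg (suc e ∸ i) y))) ⟩
    ∑< (suc (suc e)) (λ i → even-odd i + odd-even i)
      ≈⟨ ∑<-distrib-+ (suc (suc e)) even-odd odd-even ⟩
    ∑< (suc (suc e)) even-odd + (odd-even 0 + ∑< (suc e) (odd-even ∘ suc))
      ≈⟨ +-cong (trans (∑<-snoc (suc e) even-odd) (trans (+-congˡ even-odd-last) (+-identityʳ _)))
                (trans (+-congʳ (trans (*-congʳ (ζ-odd-degree-zero x)) (zeroˡ _))) (+-identityˡ _)) ⟩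
    ∑< (suc e) even-odd + ∑< (suc e) (odd-even ∘ suc)
      ≈⟨ +-comm _ _ ⟩
    ∑< (suc e) (odd-even ∘ suc) + ∑< (suc e) even-odd
      ≈⟨ +-cong (∑<-cong (suc e) (λ i _ → sym (*-identityˡ (odd-even (suc i)))))
                (∑<-cong (suc e) (λ i i≤e → trans (*-congˡ (lin-cong (ζᵇ-linear true)
                   (≈ᴹ-reflexive (≡.cong (λ d → deg d y) (ℕ.+-∸-assoc 1 (ℕ.≤-pred i≤e))))))
                   (sym (*-identityˡ (ζᵉ (i , false) x * ζᵉ (e ∸ i , true) y))))) ⟩
    ∑< (suc e) (λ i → 1# * (ζᵉ (i , true) x * ζᵉ (e ∸ i , false) y))
      + ∑< (suc e) (λ i → 1# * (ζᵉ (i , false) x * ζᵉ (e ∸ i , true) y))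
      ≈⟨ sym (trans (∑-++ (map (λ i → (i , true)) (upTo (suc e))) _ _)
           (+-cong (trans (∑-map (λ i → (i , true)) (upTo (suc e)) _) (∑-upTo (suc e) _))
                   (trans (∑-map (λ i → (i , false)) (upTo (suc e)) _) (∑-upTo (suc e) _)))) ⟩
    ∑ (entrySplits (e , true)) (λ i → 1# * (ζᵉ i x * ζᵉ (complement (e , true) i) y)) ∎
    where
      even-odd odd-even : ℕ → Carrier
      even-odd i = ζᵇ false (deg i x) * ζᵇ true (deg (suc e ∸ i) y)
      odd-even i = ζᵇ true (deg i x) * ζᵇ false (deg (suc e ∸ i) y)
      even-odd-last : even-odd (suc e) ≈ 0#
      even-odd-last = trans (*-congˡ (trans (lin-cong (ζᵇ-linear true)
        (≈ᴹ-reflexive (≡.cong (λ d → deg d y) (ℕ.n∸n≡0 e)))) (ζ-odd-degree-zero y))) (zeroʳ _)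

  entryRule : ∀ h → ProductRule (ζᵉ h)
  entryRule h = record
    { Index = ℕ × Bool ; terms = entrySplits h ; coeff = λ _ → 1#
    ; left = ζᵉ ; right = ζᵉ ∘ complement h
    ; leftParity = parityᵇ ∘ proj₂ ; rightParity = parityᵇ ∘ proj₂ ∘ complement h
    ; left-parity = ζᵉ-hasParity ; right-parity = ζᵉ-hasParity ∘ complement h
    ; rule = ζᵉ-∙ h }

  splitTerm : Carrierᴹ → Carrierᴹ → Monomial × Monomial × Bool → Carrier
  splitTerm x y (m₁ , m₂ , s) = sign s * (ζᵐ m₁ x * ζᵐ m₂ y)

  ζᵐ-∙ : ∀ m x y → ζᵐ m (x ∙ y) ≈ ∑ (splits m) (splitTerm x y)
  ζᵐ-∙ []      x y = trans (ε-∙ x y) (sym (trans (+-identityʳ _) (*-identityˡ _)))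
  ζᵐ-∙ (h ∷ m) x y = trans (⊛-∙ (ζᵉ-linear h) (ζᵐ-linear m) (entryRule h) monomialRule x y) (reindex h)
    where
      monomialRule : ProductRule (ζᵐ m)
      monomialRule = record
        { Index = Monomial × Monomial × Bool ; terms = splits m ; coeff = sign ∘ proj₂ ∘ proj₂
        ; left = ζᵐ ∘ proj₁ ; right = ζᵐ ∘ proj₁ ∘ proj₂
        ; leftParity = parM ∘ proj₁ ; rightParity = parM ∘ proj₁ ∘ proj₂
        ; left-parity = ζᵐ-hasParity ∘ proj₁ ; right-parity = ζᵐ-hasParity ∘ proj₁ ∘ proj₂
        ; rule = ζᵐ-∙ m }
      sign-xor : ∀ s m₁ → sign s * (1# * koszul odd (parM m₁)) ≈ sign (s xor nθ-odd m₁)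
      sign-xor s m₁ with parM m₁
      sign-xor false m₁ | even = trans (*-identityˡ _) (*-identityˡ _)
      sign-xor true  m₁ | even = trans (*-congˡ (*-identityˡ _)) (*-identityʳ _)
      sign-xor false m₁ | odd  = trans (*-identityˡ _) (*-identityˡ _)
      sign-xor true  m₁ | odd  = trans (*-congˡ (*-identityˡ _))
        (trans (sym (-‿distribˡ-* _ _)) (trans (-‿cong (*-identityˡ _)) (-‿involutive _)))
      term : ℕ × Bool → ℕ × Bool → Monomial × Monomial × Bool → Carrier
      term h i t = ⊛-coeff (ζᵉ-linear h) (ζᵐ-linear m) (entryRule h) monomialRule i t
                   * (ζᵐ (i ∷ proj₁ t) x * ζᵐ (complement h i ∷ proj₁ (proj₂ t)) y)
      sign-1 : ∀ s → sign s * (1# * 1#) ≈ sign s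
      sign-1 s = trans (*-congˡ (*-identityˡ 1#)) (*-identityʳ _)
      -- splits (h ∷ m) prepends the entry splits of h to the splits of m; when the θ of a dotted entry
      -- goes to the right factor it passes the θ's of m₁, the sign that splits records by xor.
      reindex : ∀ h → ∑ (splits m) (λ t → ∑ (entrySplits h) (λ i → term h i t)) ≈ ∑ (splits (h ∷ m)) (splitTerm x y)
      reindex (e , false) = sym (trans (∑-concatMap _ (splits m) _) (∑-cong (splits m) (λ t →
        trans (∑-map _ (upTo (suc e)) _) (sym (trans (∑-map _ (upTo (suc e)) _)
          (∑-cong (upTo (suc e)) (λ i → *-congʳ (sign-1 _))))))))
      reindex (e , true) = sym (trans (∑-concatMap _ (splits m) _) (∑-cong (splits m) (λ t →
        trans (∑-++ (map _ (upTo (suc e))) _ _) (trans (+-cong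
          (trans (∑-map _ (upTo (suc e)) _) (sym (trans (∑-map _ (upTo (suc e)) _)
            (∑-cong (upTo (suc e)) (λ i → *-congʳ (sign-1 _))))))
          (trans (∑-map _ (upTo (suc e)) _) (sym (trans (∑-map _ (upTo (suc e)) _)
            (∑-cong (upTo (suc e)) (λ i → *-congʳ (sign-xor (proj₂ (proj₂ t)) (proj₁ t))))))))
          (sym (∑-++ (map _ (upTo (suc e))) _ _))))))

  ζᵐ-absent∷ : ∀ m x → ζᵐ (absent ∷ m) x ≈ ζᵐ m x
  ζᵐ-absent∷ m x = trans (⊛-cong ζᵉ-absent (λ _ → refl) x) (ε-⊛ (ζᵐ-linear m) x)

  ζᵐ-++-absent : ∀ m x → ζᵐ (m ++ [ absent ]) x ≈ ζᵐ m x
  ζᵐ-++-absent []      x = trans (⊛-ε (ζᵉ-linear absent) x) (ζᵉ-absent x)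
  ζᵐ-++-absent (h ∷ m) x = ⊛-cong (λ _ → refl) (ζᵐ-++-absent m) x

  ζᵐ-monoAt : ∀ α (gs : Vec ℕ (length α)) x → ζᵐ (monoAt α gs) x ≈ ζᵐ (monoα α) x
  ζᵐ-monoAt []      []ᵛ        x = refl
  ζᵐ-monoAt (e ∷ α) (g ∷ᵛ gs) x = trans (skip g x) (⊛-cong (λ _ → refl) (ζᵐ-monoAt α gs) x)
    where
      skip : ∀ g x → ζᵐ (replicate g absent ++ entryM e ∷ monoAt α gs) x ≈ ζᵐ (entryM e ∷ monoAt α gs) x
      skip zero    x = refl
      skip (suc g) x = trans (ζᵐ-absent∷ (replicate g absent ++ entryM e ∷ monoAt α gs) x) (skip g x)

  ζᵐ-1H : ∀ m → ζᵐ m 1H ≈ 1S m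
  ζᵐ-1H []      = trans ε-1 (sym 1S-[])
  ζᵐ-1H (h ∷ m) = trans (∑⊗-resp (⊗-bilinear (ζᵉ-linear h) (ζᵐ-linear m)) Δ-1)
                        (trans (+-identityʳ (ζᵉ h 1H * ζᵐ m 1H)) (head h))
    where
      positive : ∀ h → entryDegree h ≢ 0 → ζᵉ h 1H ≈ 0#
      positive h h≢0 = trans (lin-cong (ζᵉ-linear h) (≈ᴹ-sym deg-1))
        (trans (ζᵉ-homogeneous h 0 1H) (when-no (entryDegree h ℕ.≟ 0) _ h≢0))
      head : ∀ h → ζᵉ h 1H * ζᵐ m 1H ≈ 1S (h ∷ m)
      head (zero , false)  =
        trans (*-cong (trans (ζᵉ-absent 1H) ε-1) (ζᵐ-1H m)) (trans (*-identityˡ _) (sym (1S-absent∷ m)))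
      head (suc e , false) =
        trans (*-congʳ (positive (suc e , false) (λ ()))) (trans (zeroˡ _) (sym (1S-present∷ (suc e , false) m (λ ()))))
      head (e , true)      =
        trans (*-congʳ (positive (e , true) (λ ()))) (trans (zeroˡ _) (sym (1S-present∷ (e , true) m (λ ()))))

module Universal {c ℓ a ℓa} (K : Field c ℓ) (A : Super.CombinatorialHopfSuperalgebra K a ℓa) where
  open Field K
  open Super K
  open Super.CombinatorialHopfSuperalgebra A
  open Sums commutativeRing
  open BilinearForms K
  open SQSym K
  open Compositions
  open Functionals K A
  open import Relation.Binary.Reasoning.Setoid setoid
  open import Data.List.Relation.Unary.All using ([]; _∷_)

  Ψ : Carrierᴹ → Series
  Ψ x m = ζᵐ m x

  Ψ-bounded : ∀ x → ∃ λ D → BoundedBy D (Ψ x)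
  Ψ-bounded x with deg-fin x
  ... | N , _ , x≈ = N , λ m N<m → begin
    ζᵐ m x                         ≈⟨ linear-components (ζᵐ-linear m) N x x≈ ⟩
    ∑< N (λ n → ζᵐ m (deg n x))    ≈⟨ ∑<-zero N (λ n n<N → trans (ζᵐ-homogeneous m n x)
                                        (when-no (degM m ℕ.≟ n) _ (λ m≡n → ℕ.<-irrefl (≡.sym m≡n) (ℕ.<-trans n<N N<m)))) ⟩
    0#                             ∎

  Ψ-bound : Carrierᴹ → ℕ
  Ψ-bound x = proj₁ (Ψ-bounded x)

  Ψ-∈sQSym : ∀ x → InSQSym (Ψ x)
  Ψ-∈sQSym x = ((λ m → ζᵐ-++-absent m x) , Ψ-bounded x)
             , (λ α is js → trans (ζᵐ-monoAt α is x) (sym (ζᵐ-monoAt α js x)))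

  Ψ-∈sQSym≤ : ∀ x {E} → Ψ-bound x ≤ E → InSQSym≤ E (Ψ x)
  Ψ-∈sQSym≤ x x≤E = Ψ-∈sQSym x , BoundedBy-mono x≤E (proj₂ (Ψ-bounded x))

  Ψ-cong : ∀ {x y} → x ≈ᴹ y → Ψ x ≈S Ψ y
  Ψ-cong x≈y m = lin-cong (ζᵐ-linear m) x≈y

  Ψ-par : ∀ p x → Ψ (par p x) ≈S parS p (Ψ x)
  Ψ-par p x m = trans (ζᵐ-hasParity m p x) (sym (parS-at p (Ψ x) m))

  Ψ-deg : ∀ n x → Ψ (deg n x) ≈S degS n (Ψ x)
  Ψ-deg n x m = trans (ζᵐ-homogeneous m n x) (sym (degS-at n (Ψ x) m))

  Ψ-∙ : ∀ x y → Ψ (x ∙ y) ≈S Ψ x *S Ψ y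
  Ψ-∙ x y m = ζᵐ-∙ m x y

  tensorBound : H⊗H → ℕ
  tensorBound []            = 0
  tensorBound ((x , y) ∷ t) = (Ψ-bound x ℕ.⊔ Ψ-bound y) ℕ.⊔ tensorBound t

  Ψ⊗Ψ-∈sQSym⊗≤ : ∀ t {E} → tensorBound t ≤ E → InSQSym⊗≤ E ((Ψ ⊗ᶠ Ψ) t)
  Ψ⊗Ψ-∈sQSym⊗≤ []            t≤E = []
  Ψ⊗Ψ-∈sQSym⊗≤ ((x , y) ∷ t) t≤E =
      (Ψ-∈sQSym≤ x (ℕ.≤-trans (ℕ.≤-trans (ℕ.m≤m⊔n _ (Ψ-bound y)) (ℕ.m≤m⊔n _ _)) t≤E)
     , Ψ-∈sQSym≤ y (ℕ.≤-trans (ℕ.≤-trans (ℕ.m≤n⊔m (Ψ-bound x) _) (ℕ.m≤m⊔n _ _)) t≤E))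
    ∷ Ψ⊗Ψ-∈sQSym⊗≤ t (ℕ.≤-trans (ℕ.m≤n⊔m (Ψ-bound x ℕ.⊔ Ψ-bound y) _) t≤E)

  coefficient-Ψ⊗Ψ : ∀ x β γ → coefficient β γ ((Ψ ⊗ᶠ Ψ) (Δ x)) ≈ Ψ x (monoα β ++ monoα γ)
  coefficient-Ψ⊗Ψ x β γ = trans (∑⊗-⊗ᶠ Ψ Ψ (Δ x) _) (sym (ζᵐ-++ (monoα β) (monoα γ) x))

  Ψ-ΔQ : ∀ x D → BoundedBy D (Ψ x) → ΔQ D (Ψ x) ≈SS (Ψ ⊗ᶠ Ψ) (Δ x)
  Ψ-ΔQ x D bounded = tensor-ext (D ℕ.⊔ tensorBound (Δ x))
    (ΔQ-∈sQSym⊗≤ (Ψ x) (ℕ.m≤m⊔n D _)) (Ψ⊗Ψ-∈sQSym⊗≤ (Δ x) (ℕ.m≤n⊔m D _))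
    (λ β γ → trans (ΔQ-coefficient D β γ bounded) (sym (coefficient-Ψ⊗Ψ x β γ)))

  Ψ-entry : ∀ h x → Ψ x [ h ] ≈ ζᵉ h x
  Ψ-entry h x = ⊛-ε (ζᵉ-linear h) x

  ζᵇ-via-Ψ : ∀ b x D → BoundedBy D (Ψ x) → ζᵇ b x ≈ ∑ (upTo (suc D)) (λ n → Ψ x [ (n , b) ])
  ζᵇ-via-Ψ b x D bounded with linear-expand (ζᵇ-linear b) x
  ... | N , vanish , ζx≈ = trans ζx≈ (trans (restrict b)
    (sym (trans (∑-upTo (suc D) _) (∑<-cong (suc D) (λ n _ → Ψ-entry (n , b) x)))))
    where
      beyond : ∀ h → D < entryDegree h → ζᵉ h x ≈ 0#
      beyond h D< = trans (sym (Ψ-entry h x)) (bounded [ h ] (≡.subst (D <_) (≡.sym (degM-single h)) D<))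
      vanish′ : ∀ b n → N ≤ n → ζᵇ b (deg n x) ≈ 0#
      vanish′ b n N≤n = trans (lin-cong (ζᵇ-linear b) (vanish n N≤n)) (lin-0 (ζᵇ-linear b))
      restrict : ∀ b → ∑< N (λ n → ζᵇ b (deg n x)) ≈ ∑< (suc D) (λ n → ζᵉ (n , b) x)
      restrict false = ∑<-support N (suc D) _ (vanish′ false) (λ n D<n → beyond (n , false) D<n)
      restrict true  = begin
        ∑< N (λ n → ζᵇ true (deg n x))
          ≈⟨ ∑<-support N (suc (suc D)) _ (vanish′ true)
               (λ { (suc n) (s≤s D<n) → beyond (n , true) (ℕ.m<n⇒m<1+n D<n) }) ⟩
        ζᵇ true (deg 0 x) + ∑< (suc D) (λ n → ζᵉ (n , true) x)
          ≈⟨ trans (+-congʳ (ζ-odd-degree-zero x)) (+-identityˡ _) ⟩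
        ∑< (suc D) (λ n → ζᵉ (n , true) x) ∎

  Ψ-ζ : ∀ x D → BoundedBy D (Ψ x) → ζ x ≈ε ζQ D (Ψ x)
  Ψ-ζ x D bounded = ζᵇ-via-Ψ false x D bounded , ζᵇ-via-Ψ true x D bounded

  Ψ-degree-zero : ∀ x → Ψ (deg 0 x) ≈S ε x ·S 1S
  Ψ-degree-zero x m = trans (degree-zero (ζᵐ-linear m) x) (*-congˡ (ζᵐ-1H m))

  IsLeftInverse : (Carrierᴹ → Series) → Set (a ⊔ ℓ)
  IsLeftInverse X = ∀ y m → ∑⊗ (Δ y) (λ a b → (X a *S Ψ b) m) ≈ ε y * 1S m

  module LeftInverse {X : Carrierᴹ → Series} (X-linear : ∀ m → IsLinear (λ a → X a m))
                     (X-inverse : IsLeftInverse X) where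

    *SΨ-bilinear : ∀ m → Bilinear raw raw (λ a b → (X a *S Ψ b) m)
    *SΨ-bilinear m = record
      { φ-cong  = λ a≈ b≈ → *S-cong (λ m′ → lin-cong (X-linear m′) a≈) (Ψ-cong b≈) m
      ; φ-+ˡ    = λ a a′ b → trans (*S-cong (λ m′ → lin-+ (X-linear m′) a a′) (λ _ → refl) m)
                                   (*S-distribʳ-+S _ _ _ m)
      ; φ-+ʳ    = λ a b b′ → trans (*S-cong (λ _ → refl) (λ m′ → lin-+ (ζᵐ-linear m′) b b′) m)
                                   (*S-distribˡ-+S _ _ _ m)
      ; φ-·     = λ k a b → trans (*S-cong (λ m′ → lin-· (X-linear m′) k a) (λ _ → refl) m)
                    (trans (·S-*S k _ _ m)
                           (sym (trans (*S-cong (λ _ → refl) (λ m′ → lin-· (ζᵐ-linear m′) k b) m) (*S-·S k _ _ m))))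
      ; φ-zeroˡ = λ b → trans (*S-cong (λ m′ → lin-0 (X-linear m′)) (λ _ → refl) m) (0S-*S _ m) }

    -- X-inverse at deg n z, with Δ split by degrees, determines X on degree n from lower degrees.
    recursion : ∀ m n z → X (deg n z) m + ∑< n (λ i → ∑⊗ (Δ z) (λ a b → (X (deg i a) *S Ψ (deg (n ∸ i) b)) m))
                          ≈ ε (deg n z) * 1S m
    recursion m n z = sym (begin
      ε (deg n z) * 1S m
        ≈⟨ sym (X-inverse (deg n z) m) ⟩
      ∑⊗ (Δ (deg n z)) (λ a b → (X a *S Ψ b) m)
        ≈⟨ ∑⊗-resp (*SΨ-bilinear m) (deg-Δ n z) ⟩
      ∑⊗ (concatMap (λ i → (deg i ⊗ᶠ deg (n ∸ i)) (Δ z)) (upTo (suc n))) (λ a b → (X a *S Ψ b) m)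
        ≈⟨ ∑-concatMap (λ i → (deg i ⊗ᶠ deg (n ∸ i)) (Δ z)) (upTo (suc n)) _ ⟩
      ∑ (upTo (suc n)) (λ i → ∑⊗ ((deg i ⊗ᶠ deg (n ∸ i)) (Δ z)) (λ a b → (X a *S Ψ b) m))
        ≈⟨ trans (∑-cong (upTo (suc n)) (λ i → ∑⊗-⊗ᶠ (deg i) (deg (n ∸ i)) (Δ z) _)) (∑-upTo (suc n) T) ⟩
      ∑< (suc n) T
        ≈⟨ ∑<-snoc n T ⟩
      ∑< n T + T n
        ≈⟨ trans (+-congˡ last) (+-comm _ _) ⟩
      X (deg n z) m + ∑< n T ∎)
      where
        T : ℕ → Carrier
        T i = ∑⊗ (Δ z) (λ a b → (X (deg i a) *S Ψ (deg (n ∸ i) b)) m)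
        last : T n ≈ X (deg n z) m
        last = trans (∑-cong (Δ z) (λ p → begin
            (X (deg n (proj₁ p)) *S Ψ (deg (n ∸ n) (proj₂ p))) m
              ≈⟨ *S-cong (λ _ → refl) (λ m′ → trans (reflexive (≡.cong (λ d → ζᵐ m′ (deg d (proj₂ p))) (ℕ.n∸n≡0 n)))
                                                    (Ψ-degree-zero (proj₂ p) m′)) m ⟩
            (X (deg n (proj₁ p)) *S (ε (proj₂ p) ·S 1S)) m
              ≈⟨ trans (*S-·S _ _ _ m) (*-congˡ (*S-identityʳ _ m)) ⟩
            ε (proj₂ p) * X (deg n (proj₁ p)) m
              ≈⟨ *-comm _ _ ⟩
            X (deg n (proj₁ p)) m * ε (proj₂ p) ∎))
          (⊛-ε (linear-∘ (X-linear m) (deg-linearMap n)) z)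

  left-inverse-unique : ∀ {X Y} → (∀ m → IsLinear (λ a → X a m)) → (∀ m → IsLinear (λ a → Y a m)) →
                        IsLeftInverse X → IsLeftInverse Y → ∀ x → X x ≈S Y x
  left-inverse-unique {X} {Y} X-linear Y-linear X-inverse Y-inverse x m with deg-fin x
  ... | N , _ , x≈ = begin
    X x m                          ≈⟨ linear-components (X-linear m) N x x≈ ⟩
    ∑< N (λ n → X (deg n x) m)     ≈⟨ ∑<-cong N (λ n n<N → on-degree N n n<N x m) ⟩
    ∑< N (λ n → Y (deg n x) m)     ≈⟨ sym (linear-components (Y-linear m) N x x≈) ⟩
    Y x m                          ∎
    where
      module LX = LeftInverse X-linear X-inverse
      module LY = LeftInverse Y-linear Y-inverse
      on-degree : ∀ N n → n < N → ∀ z m → X (deg n z) m ≈ Y (deg n z) m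
      on-degree (suc N) n (s≤s n≤N) z m = ∙-cancelʳ _ _ _
        (trans (LX.recursion m n z) (sym (trans (+-congˡ lower) (LY.recursion m n z))))
        where
          open import Algebra.Properties.Group +-group using (∙-cancelʳ)
          lower : ∑< n (λ i → ∑⊗ (Δ z) (λ a b → (X (deg i a) *S Ψ (deg (n ∸ i) b)) m))
                ≈ ∑< n (λ i → ∑⊗ (Δ z) (λ a b → (Y (deg i a) *S Ψ (deg (n ∸ i) b)) m))
          lower = ∑<-cong n (λ i i<n → ∑-cong (Δ z) (λ p →
            *S-cong (λ m′ → on-degree N i (ℕ.<-≤-trans i<n n≤N) (proj₁ p) m′) (λ _ → refl) m))

  Ψ-antipode : ∀ S′ → IsAntipodeQ S′ → ∀ x → Ψ (S x) ≈S S′ (Ψ x)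
  Ψ-antipode S′ (_ , S′-cong , S′-+ , S′-· , S′-left , _) =
    left-inverse-unique ΨS-linear S′Ψ-linear ΨS-inverse S′Ψ-inverse
    where
      open Antipode S′ S′-cong S′-+ S′-·

      ΨS-linear : ∀ m → IsLinear (λ a → Ψ (S a) m)
      ΨS-linear m = linear-∘ (ζᵐ-linear m) S-linearMap

      S′Ψ-linear : ∀ m → IsLinear (λ a → S′ (Ψ a) m)
      S′Ψ-linear m = record
        { lin-cong = λ {x} {y} x≈y → S′-cong (Ψ x) (Ψ y) (Ψ-∈sQSym x) (Ψ-∈sQSym y) (Ψ-cong x≈y) m
        ; lin-+    = λ x y → trans
            (S′-cong (Ψ (x +ᴹ y)) (Ψ x +S Ψ y) (Ψ-∈sQSym _) (+S-∈sQSym (Ψ-∈sQSym x) (Ψ-∈sQSym y))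
                     (λ m′ → lin-+ (ζᵐ-linear m′) x y) m)
            (S′-+ (Ψ x) (Ψ y) (Ψ-∈sQSym x) (Ψ-∈sQSym y) m)
        ; lin-·    = λ k x → trans
            (S′-cong (Ψ (k *ₗ x)) (k ·S Ψ x) (Ψ-∈sQSym _) (·S-∈sQSym k (Ψ-∈sQSym x)) (λ m′ → lin-· (ζᵐ-linear m′) k x) m)
            (S′-· k (Ψ x) (Ψ-∈sQSym x) m) }

      ΨS-inverse : IsLeftInverse (Ψ ∘ S)
      ΨS-inverse y m = begin
        ∑⊗ (Δ y) (λ a b → (Ψ (S a) *S Ψ b) m)
          ≈⟨ ∑-cong (Δ y) (λ p → sym (Ψ-∙ (S (proj₁ p)) (proj₂ p) m)) ⟩
        ∑⊗ (Δ y) (λ a b → Ψ (S a ∙ b) m)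
          ≈⟨ sym (∑⊗-lift⊗ (ζᵐ-linear m) (λ a b → S a ∙ b) (Δ y)) ⟩
        Ψ (TensorOps.lift⊗ raw raw raw (λ a b → S a ∙ b) (Δ y)) m
          ≈⟨ Ψ-cong (antipodeˡ y) m ⟩
        Ψ (ε y *ₗ 1H) m
          ≈⟨ lin-· (ζᵐ-linear m) (ε y) 1H ⟩
        ε y * Ψ 1H m
          ≈⟨ *-congˡ (ζᵐ-1H m) ⟩
        ε y * 1S m ∎

      S′Ψ-inverse : IsLeftInverse (S′ ∘ Ψ)
      S′Ψ-inverse y m = begin
        ∑⊗ (Δ y) (λ a b → (S′ (Ψ a) *S Ψ b) m)
          ≈⟨ sym (∑⊗-⊗ᶠ Ψ Ψ (Δ y) _) ⟩
        ∑⊗ ((Ψ ⊗ᶠ Ψ) (Δ y)) (λ g h → (S′ g *S h) m)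
          ≈⟨ ∑⊗-S′*S-resp (D ℕ.⊔ tensorBound (Δ y))
               (Ψ⊗Ψ-∈sQSym⊗≤ (Δ y) (ℕ.m≤n⊔m D _)) (ΔQ-∈sQSym⊗≤ (Ψ y) (ℕ.m≤m⊔n D _))
               (λ β γ → trans (coefficient-Ψ⊗Ψ y β γ) (sym (ΔQ-coefficient D β γ bounded))) m ⟩
        ∑⊗ (ΔQ D (Ψ y)) (λ g h → (S′ g *S h) m)
          ≡⟨ ≡.sym (lift⊗-at (λ g h → S′ g *S h) (ΔQ D (Ψ y)) m) ⟩
        TensorOps.lift⊗ seriesVS seriesVS seriesVS (λ g h → S′ g *S h) (ΔQ D (Ψ y)) m
          ≈⟨ S′-left (Ψ y) D (Ψ-∈sQSym y) bounded m ⟩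
        ε y * 1S m ∎
        where
          D = Ψ-bound y
          bounded = proj₂ (Ψ-bounded y)

  Ψ-isCombMorphism : IsCombMorphism A Ψ
  Ψ-isCombMorphism =
      Ψ-∈sQSym , Ψ-cong , (λ x y m → lin-+ (ζᵐ-linear m) x y) , (λ k x m → lin-· (ζᵐ-linear m) k x)
    , Ψ-par , Ψ-deg , Ψ-∙ , ζᵐ-1H , Ψ-ΔQ , (λ x → refl) , Ψ-antipode , Ψ-ζ

  component-ζQ : ∀ b D f → component b (ζQ D f) ≈ ∑ (upTo (suc D)) (λ j → f [ (j , b) ])
  component-ζQ false D f = refl
  component-ζQ true  D f = refl

  module Uniqueness (Ψ′ : Carrierᴹ → Series)
                    (Ψ′-∈sQSym : ∀ x → InSQSym (Ψ′ x))
                    (Ψ′-deg : ∀ n x → Ψ′ (deg n x) ≈S degS n (Ψ′ x))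
                    (Ψ′-ΔQ : ∀ x D → BoundedBy D (Ψ′ x) → ΔQ D (Ψ′ x) ≈SS (Ψ′ ⊗ᶠ Ψ′) (Δ x))
                    (Ψ′-ε : ∀ x → εQ (Ψ′ x) ≈ ε x)
                    (Ψ′-ζ : ∀ x D → BoundedBy D (Ψ′ x) → ζ x ≈ε ζQ D (Ψ′ x)) where
    private
      bound′ : Carrierᴹ → ℕ
      bound′ x = proj₁ (proj₂ (proj₁ (Ψ′-∈sQSym x)))
      bounded′ : ∀ x → BoundedBy (bound′ x) (Ψ′ x)
      bounded′ x = proj₂ (proj₂ (proj₁ (Ψ′-∈sQSym x)))

    -- ζ = ζQ ∘ Ψ′ on the homogeneous component of the right degree isolates a single coefficient.
    Ψ′-entry : ∀ h x → Ψ′ x [ h ] ≈ ζᵉ h x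
    Ψ′-entry (n , b) x = sym (begin
      component b (ζ y)
        ≈⟨ trans (component-cong b (Ψ′-ζ y D (bounded′ y))) (component-ζQ b D (Ψ′ y)) ⟩
      ∑ (upTo (suc D)) (λ j → Ψ′ y [ (j , b) ])
        ≈⟨ ∑-upTo (suc D) _ ⟩
      ∑< (suc D) (λ j → Ψ′ y [ (j , b) ])
        ≈⟨ ∑<-delta (suc D) _ n (λ j _ j≢n → trans (at-degree j) (when-no (degM [ (j , b) ] ℕ.≟ N) _
             (λ eq → j≢n (entryDegree-injective b (≡.trans (≡.sym (degM-single (j , b))) eq))))) ⟩
      when (n <? suc D) (Ψ′ y [ (n , b) ])
        ≈⟨ within-bound (n <? suc D) ⟩
      Ψ′ y [ (n , b) ]
        ≈⟨ trans (at-degree n) (when-yes (degM [ (n , b) ] ℕ.≟ N) _ (degM-single (n , b))) ⟩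
      Ψ′ x [ (n , b) ] ∎)
      where
        N = entryDegree (n , b)
        y = deg N x
        D = bound′ y
        at-degree : ∀ j → Ψ′ y [ (j , b) ] ≈ when (degM [ (j , b) ] ℕ.≟ N) (Ψ′ x [ (j , b) ])
        at-degree j = trans (Ψ′-deg N x [ (j , b) ]) (degS-at N (Ψ′ x) [ (j , b) ])
        entryDegree-injective : ∀ b {j n} → entryDegree (j , b) ≡ entryDegree (n , b) → j ≡ n
        entryDegree-injective false eq = eq
        entryDegree-injective true  eq = ℕ.suc-injective eq
        within-bound : (d : Dec (n < suc D)) → when d (Ψ′ y [ (n , b) ]) ≈ Ψ′ y [ (n , b) ]
        within-bound (yes _)  = refl
        within-bound (no n≮D) = sym (bounded′ y [ (n , b) ] (ℕ.<-≤-trans (ℕ.≰⇒> (n≮D ∘ s≤s))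
          (≡.subst (n ≤_) (≡.sym (degM-single (n , b))) (n≤entryDegree b))))
          where
            n≤entryDegree : ∀ b → n ≤ entryDegree (n , b)
            n≤entryDegree false = ℕ.≤-refl
            n≤entryDegree true  = ℕ.n≤1+n n

    Ψ′-monoα : ∀ α x → Ψ′ x (monoα α) ≈ Ψ x (monoα α)
    Ψ′-monoα []      x = Ψ′-ε x
    Ψ′-monoα (e ∷ α) x = begin
      Ψ′ x (monoα [ e ] ++ monoα α)
        ≈⟨ sym (ΔQ-coefficient D [ e ] α (bounded′ x)) ⟩
      coefficient [ e ] α (ΔQ D (Ψ′ x))
        ≈⟨ ∑⊗-resp (coefficient-bilinear [ e ] α) (Ψ′-ΔQ x D (bounded′ x)) ⟩
      coefficient [ e ] α ((Ψ′ ⊗ᶠ Ψ′) (Δ x))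
        ≈⟨ ∑⊗-⊗ᶠ Ψ′ Ψ′ (Δ x) _ ⟩
      ∑⊗ (Δ x) (λ u v → Ψ′ u [ entryM e ] * Ψ′ v (monoα α))
        ≈⟨ ∑-cong (Δ x) (λ p → *-cong (Ψ′-entry (entryM e) (proj₁ p)) (Ψ′-monoα α (proj₂ p))) ⟩
      Ψ x (monoα (e ∷ α)) ∎
      where D = bound′ x

    Ψ′≈Ψ : ∀ x → Ψ′ x ≈S Ψ x
    Ψ′≈Ψ x m = begin
      Ψ′ x m                             ≈⟨ normal-form (Ψ′-∈sQSym x) m ⟩
      Ψ′ x (monoα (compositionOf m))     ≈⟨ Ψ′-monoα (compositionOf m) x ⟩
      Ψ x (monoα (compositionOf m))      ≈⟨ sym (normal-form (Ψ-∈sQSym x) m) ⟩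
      Ψ x m                              ∎

  Ψ-unique : ∀ Ψ′ → IsCombMorphism A Ψ′ → ∀ x → Ψ x ≈S Ψ′ x
  Ψ-unique Ψ′ (Ψ′-∈sQSym , _ , _ , _ , _ , Ψ′-deg , _ , _ , Ψ′-ΔQ , Ψ′-ε , _ , Ψ′-ζ) x m =
    sym (Uniqueness.Ψ′≈Ψ Ψ′ Ψ′-∈sQSym Ψ′-deg Ψ′-ΔQ Ψ′-ε Ψ′-ζ x m)

theorem4p2 : ∀ {c ℓ a ℓa : Level} (K : Field c ℓ) → CharZero K →
    (A : Super.CombinatorialHopfSuperalgebra K a ℓa) →
    Σ (Super.CombinatorialHopfSuperalgebra.Carrierᴹ A → Super.Series K) (λ Ψ →
      Super.IsCombMorphism K A Ψ
      × (∀ Ψ′ → Super.IsCombMorphism K A Ψ′ →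
           ∀ x → Super._≈S_ K (Ψ x) (Ψ′ x)))
theorem4p2 K _ A = Ψ , Ψ-isCombMorphism , Ψ-unique
  where open Universal K A
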